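{- (i) Let $x\in[n]^{(k)}$ with $n/2\leq k\leq n$, and let $i_1<\dots<i_{2k-n}$ be the elements of $*'(x)$. Then the elements of $[n]^{(k-1)}\cap Q$ that are $<$-smaller than $x$ are exactly $x\setminus\{i_1\},\dots,x\setminus\{i_{2k-n}\}$. Moreover, for $u=1,\dots,2k-n$, the interval $[i_{u-1},i_u]_n$ is a maximal (under inclusion) interval in $I'(x\setminus\{i_u\})$, where the index $u-1$ is taken modulo $2k-n$. (ii) Let $n/2+1\le k\le n$, $y\in[n]^{(k-1)}$, and let $[j_1,pr'_y(j_1)]_n,\dots,[j_s,pr'_y(j_s)]_n$ be the maximal (under inclusion) intervals in $I'(y)$. Then there are exactly $s$ elements of $[n]^{(k)}$ that are $<$-larger than $y$, namely $y\cup\{pr'_y(j_r)\}$ for $r=1,\dots,s$.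
   Context: For $x\subseteq[n]$ and $1\le i\le j\le n$ let $c_x(i,j)=|x\cap[i,j]|-|[i,j]\setminus x|$. Signature $sg(x)\in\{0,1,*\}^n$: if $i\in x$ and some $j$ with $i<j\le n$ has $c_x(i,j)=0$ then $sg(x)_i=1$, else $*$; if $i\notin x$ and some $j$ with $1\le j<i$ has $c_x(j,i)=0$ then $sg(x)_i=0$, else $*$. Let $x\sim y$ iff $sg(x)=sg(y)$ (classes are symmetric chains). $Q=[n]^{(\ge n/2)}$; for $x\in Q$, $p(x)$ is the unique element of the $\sim$-class of $x$ with $|x|+|p(x)|=n$; for $x,y\in Q$, $y<x$ iff $y\ne x$ and $p(x)\subseteq p(y)\subseteq y\subseteq x$. Circular signature: identify $[n]$ with $\mathbb{Z}_n$; $[i,j]_n=[i,j]$ if $i\le j$, $[i,n]\cup[1,j]$ if $i>j$; $c'_x(i,j)=|[i,j]_n\cap x|-|[i,j]_n\setminus x|$. If $i\in x$ and some $j$ has $c'_x(i,j)=0$, then $csg(x)_i=1$ and $pr'_x(i)$ is such $j$ minimizing $|[i,j]_n|$; else $csg(x)_i=*$. If $i\notin x$ and some $j$ has $c'_x(j,i)=0$, then $csg(x)_i=0$ and $pr'_x(i)$ is such $j$ minimizing $|[j,i]_n|$; else $csg(x)_i=*$. $*'(x)=\{i:csg(x)_i=*\}$, $1'(x)=\{i:csg(x)_i=1\}$, $I'(x)=\{[i,pr'_x(i)]_n:i\in 1'(x)\}$. -}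

module Defs where

open import Data.Bool using (Bool; true; false; if_then_else_; _∧_; _∨_)
open import Data.Nat using (ℕ; zero; suc; _+_; _*_)
  renaming (_≤_ to _≤ℕ_)
open import Data.Fin using (Fin; zero; suc; fromℕ; inject₁; _≤_; _<_)
open import Data.Fin.Properties using (_≤?_; _<?_; any?)
open import Data.Fin.Subset using (Subset; _∈_; _∉_; _⊆_; _∩_; _─_; ∣_∣)
open import Data.Fin.Subset.Properties using (_∈?_)
open import Data.Integer using (ℤ; +_; _-_)
import Data.Integer.Properties as ℤP
open import Data.Product using (Σ; ∃; ∃₂; _×_; _,_)
open import Data.Sum using (_⊎_)
open import Data.Vec using (tabulate)
open import Relation.Nullary using (¬_; Dec; does)
open import Relation.Nullary.Decidable using (_×-dec_)
open import Relation.Binary.PropositionalEquality using (_≡_; _≢_)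

-- Elements of [n] are represented by Fin n (0-indexed, order preserved);
-- subsets of [n] by Data.Fin.Subset (Vec Bool n).

interval : ∀ {n} → Fin n → Fin n → Subset n
interval i j = tabulate λ t → does (i ≤? t) ∧ does (t ≤? j)

cinterval : ∀ {n} → Fin n → Fin n → Subset n
cinterval i j =
  if does (i ≤? j) then interval i j
  else tabulate (λ t → does (i ≤? t) ∨ does (t ≤? j))

balance : ∀ {n} → Subset n → Subset n → ℤ
balance x I = + ∣ x ∩ I ∣ - + ∣ I ─ x ∣

-- c_x(i,j) (used only for i ≤ j) and c'_x(i,j)
c : ∀ {n} → Subset n → Fin n → Fin n → ℤ
c x i j = balance x (interval i j)

c′ : ∀ {n} → Subset n → Fin n → Fin n → ℤ
c′ x i j = balance x (cinterval i j)

data Sym : Set where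
  s0 s1 s* : Sym

sg : ∀ {n} → Subset n → Fin n → Sym
sg x i =
  if does (i ∈? x)
  then (if does (any? (λ j → (i <? j) ×-dec (c x i j ℤP.≟ + 0))) then s1 else s*)
  else (if does (any? (λ j → (j <? i) ×-dec (c x j i ℤP.≟ + 0))) then s0 else s*)

csg : ∀ {n} → Subset n → Fin n → Sym
csg x i =
  if does (i ∈? x)
  then (if does (any? (λ j → c′ x i j ℤP.≟ + 0)) then s1 else s*)
  else (if does (any? (λ j → c′ x j i ℤP.≟ + 0)) then s0 else s*)

-- pr'_x(i) = j, for i ∈ x (the case relevant for I'(x)):
-- c'_x(i,j) = 0 and |[i,j]_n| is minimal among such j
IsPr′ : ∀ {n} → Subset n → Fin n → Fin n → Set
IsPr′ x i j =
  i ∈ x × c′ x i j ≡ + 0 ×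
  (∀ j′ → c′ x i j′ ≡ + 0 → ∣ cinterval i j ∣ ≤ℕ ∣ cinterval i j′ ∣)

InI′ : ∀ {n} → Subset n → Subset n → Set
InI′ x J = Σ _ λ i → csg x i ≡ s1 × Σ _ λ j → IsPr′ x i j × J ≡ cinterval i j

MaxI′ : ∀ {n} → Subset n → Subset n → Set
MaxI′ x J = InI′ x J × (∀ K → InI′ x K → J ⊆ K → K ≡ J)

InQ : ∀ {n} → Subset n → Set
InQ {n} x = n ≤ℕ 2 * ∣ x ∣

IsP : ∀ {n} → Subset n → Subset n → Set
IsP {n} x z = (∀ i → sg z i ≡ sg x i) × ∣ x ∣ + ∣ z ∣ ≡ n

_≺_ : ∀ {n} → Subset n → Subset n → Set
y ≺ x = InQ x × InQ y × y ≢ x ×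
  ∃₂ λ px py → IsP x px × IsP y py × px ⊆ py × py ⊆ y × y ⊆ x

predMod : ∀ {m} → Fin m → Fin m
predMod {suc m} zero = fromℕ m
predMod {suc m} (suc u) = inject₁ u

{-# OPTIONS --safe #-}
-- Read x ⊆ [n] as the n-periodic walk W that steps up at the elements of x and down elsewhere.
-- Then c′_x is a difference of walk values, and for x ∈ Q the walk has non-negative drift per period.
-- An element of x has circular signature * exactly when the walk never comes back to its level
-- afterwards (a "star"). Turning every star step of x into a down step lowers the walk by twice the
-- rise of its future minimum; this leaves the linear signature unchanged and has n − |x| up steps,
-- so p(x) is the set of positions of circular signature 1. Hence, for |y| = |x| − 1 in Q, y < x
-- holds exactly when y is x with one star removed.
-- (i) Between consecutive stars j, b of x the walk rises by exactly one, so in x − b the interval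
-- [j, b] is a first return whose end b is never undercut later, which makes it maximal.
-- (ii) Dually, y ∪ {b} covers y exactly when after the down step at b the walk of y stays at or
-- above its new level for a period; these b are the ends of the maximal intervals of I′(y), since a
-- dip after such an end would produce a first return enclosing the interval.
module Submission where

open import Defs
open import Data.Nat using (ℕ; _+_; _*_; _∸_) renaming (_≤_ to _≤ℕ_)
open import Data.Fin using (Fin; _<_)
open import Data.Fin.Subset using (Subset; _-_; _∪_; ⁅_⁆; ∣_∣)
open import Data.Product using (∃; _×_)
open import Function.Bundles using (_⇔_)
open import Relation.Binary.PropositionalEquality using (_≡_; _≢_)

open import Data.Bool using (Bool; true; false; not; _∧_; _∨_; if_then_else_; T)
import Data.Nat as N
open N using (zero; suc; z≤n; s≤s)
import Data.Nat.Properties as NP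
open import Data.Nat.Induction using (<-rec)
open import Data.Nat.DivMod using (_%_; _/_; _mod_; m<n⇒m%n≡m; [m+n]%n≡m%n; m≡m%n+[m/n]*n; %-distribˡ-+; m%n<n; m≤n⇒[n∸m]%m≡n%m)
import Data.Integer as Z
open Z using (ℤ; +_; 0ℤ; 1ℤ; -1ℤ)
import Data.Integer.Properties as ZP
open import Data.Integer.Tactic.RingSolver using (solve-∀)
import Data.Fin as F
open F using (toℕ; fromℕ; inject₁)
import Data.Fin.Properties as FP
open import Data.Fin.Subset using (_∩_; _─_; _∈_; _∉_; _⊆_)
open import Data.Fin.Subset.Properties using (_∈?_; p⊂q⇒∣p∣<∣q∣; x∈⁅x⁆; x∈⁅y⁆⇒x≡y; x∈p∧x≢y⇒x∈p-y; x∈p∪q⁻; x∈p∪q⁺; ⊆-antisym; p─⊥≡p)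
open import Data.Vec using ([]; _∷_; lookup; tabulate; here; there)
import Data.Vec.Properties as VP
open import Data.Product using (Σ; _,_; proj₁; proj₂)
open import Data.Sum using (_⊎_; inj₁; inj₂; [_,_]′)
open import Data.Empty using (⊥; ⊥-elim)
open import Relation.Nullary using (¬_; Dec; yes; no; does)
open import Relation.Nullary.Decidable using (_×-dec_; dec-false; dec-true; ¬?)
open import Relation.Binary.PropositionalEquality using (refl; sym; trans; cong; cong₂; subst; subst₂; module ≡-Reasoning)
open import Relation.Binary using (tri<; tri≈; tri>)
open import Function.Bundles using (mk⇔; Equivalence)

≤-by-diff : ∀ {a b c d : ℤ} → a Z.≤ b → c Z.- d ≡ a Z.- b → c Z.≤ d
≤-by-diff h eq = ZP.i-j≤0⇒i≤j (subst (Z._≤ 0ℤ) (sym eq) (ZP.i≤j⇒i-j≤0 h))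

≤-by-diff₂ : ∀ {a₁ b₁ a₂ b₂ c d : ℤ} → a₁ Z.≤ b₁ → a₂ Z.≤ b₂ →
             c Z.- d ≡ (a₁ Z.+ a₂) Z.- (b₁ Z.+ b₂) → c Z.≤ d
≤-by-diff₂ h₁ h₂ = ≤-by-diff (ZP.+-mono-≤ h₁ h₂)

<⇒+1≤ : ∀ {a b : ℤ} → a Z.< b → a Z.+ 1ℤ Z.≤ b
<⇒+1≤ {a} {b} h = subst (Z._≤ b) (ZP.+-comm 1ℤ a) (ZP.i<j⇒suc[i]≤j h)

+1≤⇒< : ∀ {a b : ℤ} → a Z.+ 1ℤ Z.≤ b → a Z.< b
+1≤⇒< {a} {b} h = ZP.suc[i]≤j⇒i<j (subst (Z._≤ b) (ZP.+-comm a 1ℤ) h)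

<-by-diff : ∀ {a b c d : ℤ} → a Z.< b → b Z.- a Z.≤ d Z.- c → c Z.< d
<-by-diff {a} {b} {c} {d} h₁ h₂ = +1≤⇒< (≤-by-diff₂ (<⇒+1≤ h₁) h₂ (e a b c d))
  where
  e : ∀ a b c d → c Z.+ 1ℤ Z.- d ≡ (a Z.+ 1ℤ Z.+ (b Z.- a)) Z.- (b Z.+ (d Z.- c))
  e = solve-∀

<∧≤+1⇒≡+1 : ∀ {a b : ℤ} → a Z.< b → b Z.≤ a Z.+ 1ℤ → a Z.+ 1ℤ ≡ b
<∧≤+1⇒≡+1 h₁ h₂ = ZP.≤-antisym (<⇒+1≤ h₁) h₂

+1-injective : ∀ {a c : ℤ} → a Z.+ 1ℤ ≡ c Z.+ 1ℤ → a ≡ c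
+1-injective {a} {c} e = trans (e′ a) (trans (cong (Z._- 1ℤ) e) (sym (e′ c)))
  where
  e′ : ∀ a → a ≡ a Z.+ 1ℤ Z.- 1ℤ
  e′ = solve-∀

0≤⇒≤+ : ∀ {d} a → 0ℤ Z.≤ d → a Z.≤ a Z.+ d
0≤⇒≤+ a (Z.+≤+ _) = ZP.i≤i+j a _

∑< : (ℕ → ℤ) → ℕ → ℤ
∑< f zero = 0ℤ
∑< f (suc t) = ∑< f t Z.+ f t

∑<-suc : ∀ (f : ℕ → ℤ) N → ∑< f (suc N) ≡ f 0 Z.+ ∑< (λ t → f (suc t)) N
∑<-suc f zero = ZP.+-comm 0ℤ (f 0)
∑<-suc f (suc N) = begin
    ∑< f (suc N) Z.+ f (suc N)
  ≡⟨ cong (Z._+ f (suc N)) (∑<-suc f N) ⟩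
    f 0 Z.+ ∑< (λ t → f (suc t)) N Z.+ f (suc N)
  ≡⟨ ZP.+-assoc (f 0) _ _ ⟩
    f 0 Z.+ (∑< (λ t → f (suc t)) N Z.+ f (suc N)) ∎
  where open ≡-Reasoning

∑<-one : ∀ N → ∑< (λ _ → 1ℤ) N ≡ + N
∑<-one zero = refl
∑<-one (suc N) = trans (cong (Z._+ 1ℤ) (∑<-one N)) (cong +_ (NP.+-comm N 1))

module BoundedSearch {Q : ℕ → Set} (Q? : ∀ t → Dec (Q t)) where

  Least : ℕ → ℕ → Set
  Least a t = Σ ℕ λ s → a N.≤ s × s N.≤ t × Q s × (∀ r → a N.≤ r → r N.< s → ¬ Q r)

  Greatest : ℕ → ℕ → Set
  Greatest a t = Σ ℕ λ s → a N.≤ s × s N.≤ t × Q s × (∀ r → s N.< r → r N.≤ t → ¬ Q r)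

  private
    leastFrom : ∀ k a → Q (k N.+ a) → Least a (k N.+ a)
    leastFrom k a q with Q? a
    ... | yes qa = a , NP.≤-refl , NP.m≤n+m a k , qa , λ r a≤r r<a _ → NP.<-irrefl refl (NP.≤-<-trans a≤r r<a)
    leastFrom zero a q | no ¬qa = ⊥-elim (¬qa q)
    leastFrom (suc k) a q | no ¬qa with leastFrom k (suc a) (subst Q (sym (NP.+-suc k a)) q)
    ... | s , a<s , s≤ , qs , below = s , NP.<⇒≤ a<s , NP.≤-trans s≤ (NP.≤-reflexive (NP.+-suc k a)) , qs , below′
      where
      below′ : ∀ r → a N.≤ r → r N.< s → ¬ Q r
      below′ r a≤r r<s with NP.m≤n⇒m<n∨m≡n a≤r
      ... | inj₁ a<r = below r a<r r<s
      ... | inj₂ refl = ¬qa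

    greatestUpTo : ∀ k t → Q t → Greatest t (k N.+ t)
    greatestUpTo zero t q = t , NP.≤-refl , NP.≤-refl , q , λ r t<r r≤t _ → NP.<-irrefl refl (NP.<-≤-trans t<r r≤t)
    greatestUpTo (suc k) t q with Q? (suc (k N.+ t))
    ... | yes q′ = suc (k N.+ t) , NP.m≤n⇒m≤1+n (NP.m≤n+m t k) , NP.≤-refl , q′ , λ r s<r r≤s _ → NP.<-irrefl refl (NP.<-≤-trans s<r r≤s)
    ... | no ¬q′ with greatestUpTo k t q
    ... | s , t≤s , s≤ , qs , above = s , t≤s , NP.m≤n⇒m≤1+n s≤ , qs , above′
      where
      above′ : ∀ r → s N.< r → r N.≤ suc (k N.+ t) → ¬ Q r
      above′ r s<r r≤ with NP.m≤n⇒m<n∨m≡n r≤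
      ... | inj₁ r<  = above r s<r (NP.≤-pred r<)
      ... | inj₂ refl = ¬q′

  least : ∀ a t → a N.≤ t → Q t → Least a t
  least a t a≤t q with leastFrom (t N.∸ a) a (subst Q (sym (NP.m∸n+n≡m a≤t)) q)
  ... | s , a≤s , s≤ , qs , below = s , a≤s , subst (s N.≤_) (NP.m∸n+n≡m a≤t) s≤ , qs , below

  greatest : ∀ t b → t N.≤ b → Q t → Greatest t b
  greatest t b t≤b q with greatestUpTo (b N.∸ t) t q
  ... | s , t≤s , s≤ , qs , above = s , t≤s , subst (s N.≤_) (NP.m∸n+n≡m t≤b) s≤ , qs ,
        λ r s<r r≤b → above r s<r (subst (r N.≤_) (sym (NP.m∸n+n≡m t≤b)) r≤b)

-- Walks with steps ±1

step : Bool → ℤ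
step true = 1ℤ
step false = -1ℤ

module Walk (b : ℕ → Bool) where

  W : ℕ → ℤ
  W = ∑< (λ s → step (b s))

  W-up : ∀ t → b t ≡ true → W (suc t) ≡ W t Z.+ 1ℤ
  W-up t h rewrite h = refl

  W-down : ∀ t → b t ≡ false → W (suc t) Z.+ 1ℤ ≡ W t
  W-down t h rewrite h = e (W t)
    where
    e : ∀ a → a Z.+ -1ℤ Z.+ 1ℤ ≡ a
    e = solve-∀

  W-suc≤W+1 : ∀ t → W (suc t) Z.≤ W t Z.+ 1ℤ
  W-suc≤W+1 t with b t
  ... | true = ZP.≤-refl
  ... | false = ≤-by-diff { -1ℤ} {1ℤ} Z.-≤+ (e (W t))
    where
    e : ∀ a → a Z.+ -1ℤ Z.- (a Z.+ 1ℤ) ≡ -1ℤ Z.- 1ℤ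
    e = solve-∀

  W≤W-suc+1 : ∀ t → W t Z.≤ W (suc t) Z.+ 1ℤ
  W≤W-suc+1 t with b t
  ... | true = ≤-by-diff { -1ℤ} {1ℤ} Z.-≤+ (e (W t))
    where
    e : ∀ a → a Z.- (a Z.+ 1ℤ Z.+ 1ℤ) ≡ -1ℤ Z.- 1ℤ
    e = solve-∀
  ... | false = ZP.≤-reflexive (e (W t))
    where
    e : ∀ a → a ≡ a Z.+ -1ℤ Z.+ 1ℤ
    e = solve-∀

  up⇒W<W-suc : ∀ t → b t ≡ true → W t Z.< W (suc t)
  up⇒W<W-suc t h = +1≤⇒< (ZP.≤-reflexive (sym (W-up t h)))

  down⇒W-suc<W : ∀ t → b t ≡ false → W (suc t) Z.< W t
  down⇒W-suc<W t h = +1≤⇒< (ZP.≤-reflexive (W-down t h))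

  W<W-suc⇒up : ∀ t → W t Z.< W (suc t) → b t ≡ true
  W<W-suc⇒up t h = cases (b t) refl
    where
    cases : ∀ c → b t ≡ c → b t ≡ true
    cases true eq = eq
    cases false eq = ⊥-elim (ZP.<-asym h (down⇒W-suc<W t eq))

  W-suc<W⇒down : ∀ t → W (suc t) Z.< W t → b t ≡ false
  W-suc<W⇒down t h = cases (b t) refl
    where
    cases : ∀ c → b t ≡ c → b t ≡ false
    cases false eq = eq
    cases true eq = ⊥-elim (ZP.<-asym h (up⇒W<W-suc t eq))

  W-suc≢W : ∀ t → W (suc t) ≢ W t
  W-suc≢W t e = cases (b t) refl
    where
    cases : ∀ c → b t ≡ c → ⊥
    cases true eq = ZP.<-irrefl (sym e) (up⇒W<W-suc t eq)
    cases false eq = ZP.<-irrefl e (down⇒W-suc<W t eq)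

  private
    ivt↓ₖ : ∀ k a v → v Z.≤ W a → W (k N.+ a) Z.≤ v → Σ ℕ λ t → a N.≤ t × t N.≤ k N.+ a × W t ≡ v
    ivt↓ₖ zero a v h₁ h₂ = a , NP.≤-refl , NP.≤-refl , ZP.≤-antisym h₂ h₁
    ivt↓ₖ (suc k) a v h₁ h₂ with W a ZP.≟ v
    ... | yes eq = a , NP.≤-refl , NP.m≤n+m a (suc k) , eq
    ... | no ne with ivt↓ₖ k (suc a) v v≤W-suc (subst (λ u → W u Z.≤ v) (sym (NP.+-suc k a)) h₂)
      where
      v≤W-suc : v Z.≤ W (suc a)
      v≤W-suc = ≤-by-diff₂ (<⇒+1≤ (ZP.≤∧≢⇒< h₁ (λ e → ne (sym e)))) (W≤W-suc+1 a) (e v (W a) (W (suc a)))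
        where
        e : ∀ v w w′ → v Z.- w′ ≡ (v Z.+ 1ℤ Z.+ w) Z.- (w Z.+ (w′ Z.+ 1ℤ))
        e = solve-∀
    ... | t , a<t , t≤ , eq = t , NP.<⇒≤ a<t , NP.≤-trans t≤ (NP.≤-reflexive (NP.+-suc k a)) , eq

    ivt↑ₖ : ∀ k a v → W a Z.≤ v → v Z.≤ W (k N.+ a) → Σ ℕ λ t → a N.≤ t × t N.≤ k N.+ a × W t ≡ v
    ivt↑ₖ zero a v h₁ h₂ = a , NP.≤-refl , NP.≤-refl , ZP.≤-antisym h₁ h₂
    ivt↑ₖ (suc k) a v h₁ h₂ with W a ZP.≟ v
    ... | yes eq = a , NP.≤-refl , NP.m≤n+m a (suc k) , eq
    ... | no ne with ivt↑ₖ k (suc a) v W-suc≤v (subst (λ u → v Z.≤ W u) (sym (NP.+-suc k a)) h₂)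
      where
      W-suc≤v : W (suc a) Z.≤ v
      W-suc≤v = ≤-by-diff₂ (<⇒+1≤ (ZP.≤∧≢⇒< h₁ ne)) (W-suc≤W+1 a) (e v (W a) (W (suc a)))
        where
        e : ∀ v w w′ → w′ Z.- v ≡ (w Z.+ 1ℤ Z.+ w′) Z.- (v Z.+ (w Z.+ 1ℤ))
        e = solve-∀
    ... | t , a<t , t≤ , eq = t , NP.<⇒≤ a<t , NP.≤-trans t≤ (NP.≤-reflexive (NP.+-suc k a)) , eq

  ivt↓ : ∀ a c v → a N.≤ c → v Z.≤ W a → W c Z.≤ v → Σ ℕ λ t → a N.≤ t × t N.≤ c × W t ≡ v
  ivt↓ a c v a≤c h₁ h₂ with ivt↓ₖ (c N.∸ a) a v h₁ (subst (λ u → W u Z.≤ v) (sym (NP.m∸n+n≡m a≤c)) h₂)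
  ... | t , a≤t , t≤ , eq = t , a≤t , subst (t N.≤_) (NP.m∸n+n≡m a≤c) t≤ , eq

  ivt↑ : ∀ a c v → a N.≤ c → W a Z.≤ v → v Z.≤ W c → Σ ℕ λ t → a N.≤ t × t N.≤ c × W t ≡ v
  ivt↑ a c v a≤c h₁ h₂ with ivt↑ₖ (c N.∸ a) a v h₁ (subst (λ u → v Z.≤ W u) (sym (NP.m∸n+n≡m a≤c)) h₂)
  ... | t , a≤t , t≤ , eq = t , a≤t , subst (t N.≤_) (NP.m∸n+n≡m a≤c) t≤ , eq

  ≤∧<-suc⇒≡ : ∀ t v → W t Z.≤ v → v Z.< W (suc t) → W t ≡ v
  ≤∧<-suc⇒≡ t v h₁ h₂ = ZP.≤-antisym h₁ (≤-by-diff₂ (<⇒+1≤ h₂) (W-suc≤W+1 t) (e v (W t) (W (suc t))))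
    where
    e : ∀ a b c → a Z.- b ≡ (a Z.+ 1ℤ Z.+ c) Z.- (c Z.+ (b Z.+ 1ℤ))
    e = solve-∀

  up-never-returns⇒above : ∀ r N → b r ≡ true → (∀ t → r N.< t → t N.≤ N → W t ≢ W r) →
                           ∀ s → r N.< s → s N.≤ N → W r Z.< W s
  up-never-returns⇒above r N br h s r<s s≤N with W r ZP.<? W s
  ... | yes lt = lt
  ... | no ≮ with ivt↓ (suc r) s (W r) r<s (ZP.<⇒≤ (up⇒W<W-suc r br)) (ZP.≮⇒≥ ≮)
  ... | t , r<t , t≤s , e = ⊥-elim (h t r<t (NP.≤-trans t≤s s≤N) e)

  down-never-visited⇒above : ∀ r → b r ≡ false → (∀ t → t N.< r → W t ≢ W (suc r)) →
                             ∀ s → s N.≤ r → W (suc r) Z.< W s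
  down-never-visited⇒above r br h s s≤r with W (suc r) ZP.<? W s
  ... | yes lt = lt
  ... | no ≮ with ivt↑ s r (W (suc r)) s≤r (ZP.≮⇒≥ ≮) (ZP.<⇒≤ (down⇒W-suc<W r br))
  ... | t , s≤t , t≤r , e with NP.m≤n⇒m<n∨m≡n t≤r
  ... | inj₁ t<r = ⊥-elim (h t t<r e)
  ... | inj₂ refl = ⊥-elim (W-suc≢W t (sym e))

  FirstReturn : ℕ → ℕ → Set
  FirstReturn r L = (1 N.≤ L) × (W (L N.+ r) ≡ W r) × (∀ s → r N.< s → s N.< L N.+ r → W r Z.< W s)

  FirstReturn⇒up : ∀ r L → FirstReturn r L → b r ≡ true
  FirstReturn⇒up r L (1≤L , e , above) with NP.m≤n⇒m<n∨m≡n 1≤L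
  ... | inj₁ 1<L = W<W-suc⇒up r (above (suc r) NP.≤-refl (NP.+-monoˡ-< r 1<L))
  ... | inj₂ refl = ⊥-elim (W-suc≢W r e)

  FirstReturn⇒last-down : ∀ r L → FirstReturn r L → b (L N.∸ 1 N.+ r) ≡ false
  FirstReturn⇒last-down r (suc zero) (_ , e , _) = ⊥-elim (W-suc≢W r e)
  FirstReturn⇒last-down r (suc (suc L)) (_ , e , above) =
    W-suc<W⇒down (suc L N.+ r) (subst (Z._< W (suc L N.+ r)) (sym e) (above (suc L N.+ r) (s≤s (NP.m≤n+m r L)) NP.≤-refl))

module PeriodicWalk (b : ℕ → Bool) (m : ℕ) (periodic : ∀ t → b (t N.+ suc m) ≡ b t) where
  open Walk b public

  n : ℕ
  n = suc m

  drift : ℤ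
  drift = W n

  W-period : ∀ t → W (t N.+ n) ≡ W t Z.+ drift
  W-period zero = sym (ZP.+-identityˡ drift)
  W-period (suc t) = trans (cong₂ Z._+_ (W-period t) (cong step (periodic t))) (e (W t) drift (step (b t)))
    where
    e : ∀ a d s → a Z.+ d Z.+ s ≡ a Z.+ s Z.+ d
    e = solve-∀

  W-periods : ∀ q t → W (t N.+ q N.* n) ≡ W t Z.+ (+ q) Z.* drift
  W-periods zero t = trans (cong W (NP.+-identityʳ t)) (e (W t) drift)
    where
    e : ∀ a d → a ≡ a Z.+ 0ℤ Z.* d
    e = solve-∀
  W-periods (suc q) t = begin
      W (t N.+ (n N.+ q N.* n))
    ≡⟨ cong W (trans (cong (t N.+_) (NP.+-comm n (q N.* n))) (sym (NP.+-assoc t (q N.* n) n))) ⟩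
      W ((t N.+ q N.* n) N.+ n)
    ≡⟨ W-period (t N.+ q N.* n) ⟩
      W (t N.+ q N.* n) Z.+ drift
    ≡⟨ cong (Z._+ drift) (W-periods q t) ⟩
      W t Z.+ (+ q) Z.* drift Z.+ drift
    ≡⟨ e (W t) (+ q) drift ⟩
      W t Z.+ (1ℤ Z.+ + q) Z.* drift ∎
    where
    open ≡-Reasoning
    e : ∀ a q d → a Z.+ q Z.* d Z.+ d ≡ a Z.+ (1ℤ Z.+ q) Z.* d
    e = solve-∀

  W-diff-periods : ∀ q s t → W (s N.+ q N.* n) Z.- W (t N.+ q N.* n) ≡ W s Z.- W t
  W-diff-periods q s t rewrite W-periods q s | W-periods q t = e (W s) (W t) (+ q Z.* drift)
    where
    e : ∀ a c x → a Z.+ x Z.- (c Z.+ x) ≡ a Z.- c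
    e = solve-∀

  module NonNegativeDrift (drift≥0 : 0ℤ Z.≤ drift) where

    W≤W+period : ∀ t → W t Z.≤ W (t N.+ n)
    W≤W+period t = subst (W t Z.≤_) (sym (W-period t)) (0≤⇒≤+ (W t) drift≥0)

    lowWithin : ℕ → ℕ → ℤ
    lowWithin t zero = W t
    lowWithin t (suc l) = W t Z.⊓ lowWithin (suc t) l

    lowWithin≤ : ∀ l t d → d N.≤ l → lowWithin t l Z.≤ W (d N.+ t)
    lowWithin≤ zero t .zero z≤n = ZP.≤-refl
    lowWithin≤ (suc l) t zero _ = ZP.i⊓j≤i (W t) _
    lowWithin≤ (suc l) t (suc d) (s≤s d≤l) =
      ZP.≤-trans (ZP.i⊓j≤j (W t) _) (subst (λ u → lowWithin (suc t) l Z.≤ W u) (NP.+-suc d t) (lowWithin≤ l (suc t) d d≤l))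

    lowWithin-attained : ∀ l t → Σ ℕ λ d → d N.≤ l × lowWithin t l ≡ W (d N.+ t)
    lowWithin-attained zero t = 0 , z≤n , refl
    lowWithin-attained (suc l) t with ZP.⊓-sel (W t) (lowWithin (suc t) l)
    ... | inj₁ e = 0 , z≤n , e
    ... | inj₂ e with lowWithin-attained l (suc t)
    ... | d , d≤l , e′ = suc d , s≤s d≤l , trans e (trans e′ (cong W (NP.+-suc d t)))

    -- Since the drift is non-negative, the minimum over one period is the minimum over the whole future.
    low : ℕ → ℤ
    low t = lowWithin t n

    low≤W : ∀ s t → t N.≤ s → low t Z.≤ W s
    low≤W = <-rec (λ s → ∀ t → t N.≤ s → low t Z.≤ W s) go
      where
      go : ∀ s → (∀ {s′} → s′ N.< s → ∀ t → t N.≤ s′ → low t Z.≤ W s′) → ∀ t → t N.≤ s → low t Z.≤ W s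
      go s rec t t≤s with (s N.∸ t) NP.≤? n
      ... | yes d≤n = subst (λ u → low t Z.≤ W u) (NP.m∸n+n≡m t≤s) (lowWithin≤ n t (s N.∸ t) d≤n)
      ... | no d>n = ZP.≤-trans (rec s′<s t t≤s′) (subst (W s′ Z.≤_) (cong W s′+n≡s) (W≤W+period s′))
        where
        s′ : ℕ
        s′ = s N.∸ n
        n<d : n N.< s N.∸ t
        n<d = NP.≰⇒> d>n
        n≤s : n N.≤ s
        n≤s = NP.≤-trans (NP.<⇒≤ n<d) (NP.m∸n≤m s t)
        s′+n≡s : s′ N.+ n ≡ s
        s′+n≡s = NP.m∸n+n≡m n≤s
        s′<s : s′ N.< s
        s′<s = NP.∸-monoʳ-< {s} {n} {0} (s≤s z≤n) n≤s
        t≤s′ : t N.≤ s′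
        t≤s′ = NP.m+n≤o⇒m≤o∸n t (subst (N._≤ s) (NP.+-comm n t) (NP.m≤o∸n⇒m+n≤o n t≤s (NP.<⇒≤ n<d)))

    low-attained : ∀ t → Σ ℕ λ s → t N.≤ s × s N.≤ n N.+ t × low t ≡ W s
    low-attained t with lowWithin-attained n t
    ... | d , d≤n , e = d N.+ t , NP.m≤n+m t d , NP.+-monoˡ-≤ t d≤n , e

    low≤W-self : ∀ t → low t Z.≤ W t
    low≤W-self t = low≤W t t NP.≤-refl

    low-mono : ∀ t s → t N.≤ s → low t Z.≤ low s
    low-mono t s t≤s with low-attained s
    ... | s′ , s≤s′ , _ , e = subst (low t Z.≤_) (sym e) (low≤W s′ t (NP.≤-trans t≤s s≤s′))

    low-period : ∀ t → low (t N.+ n) ≡ low t Z.+ drift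
    low-period t = ZP.≤-antisym ≤ ≥
      where
      ≤ : low (t N.+ n) Z.≤ low t Z.+ drift
      ≤ with low-attained t
      ... | s , t≤s , _ , e = subst (low (t N.+ n) Z.≤_) (trans (W-period s) (cong (Z._+ drift) (sym e))) (low≤W (s N.+ n) (t N.+ n) (NP.+-monoˡ-≤ n t≤s))
      ≥ : low t Z.+ drift Z.≤ low (t N.+ n)
      ≥ with low-attained (t N.+ n)
      ... | s , tn≤s , _ , e = subst (low t Z.+ drift Z.≤_) (trans (trans (sym (W-period s′)) (cong W s′+n≡s)) (sym e)) (ZP.+-monoˡ-≤ drift (low≤W s′ t t≤s′))
        where
        s′ : ℕ
        s′ = s N.∸ n
        s′+n≡s : s′ N.+ n ≡ s
        s′+n≡s = NP.m∸n+n≡m (NP.≤-trans (NP.m≤n+m n t) tn≤s)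
        t≤s′ : t N.≤ s′
        t≤s′ = NP.m+n≤o⇒m≤o∸n t tn≤s

    -- These will be the positions of circular signature *.
    Star : ℕ → Set
    Star t = W t Z.< low (suc t)

    Star? : ∀ t → Dec (Star t)
    Star? t = W t ZP.<? low (suc t)

    Star⇒below : ∀ t → Star t → ∀ s → t N.< s → W t Z.< W s
    Star⇒below t h s t<s = ZP.<-≤-trans h (low≤W s (suc t) t<s)

    Star-step : ∀ t → Star t → (low t ≡ W t) × (low (suc t) ≡ W t Z.+ 1ℤ) × (b t ≡ true)
    Star-step t h = low≡W , low-suc≡ , up
      where
      low≡W : low t ≡ W t
      low≡W with low-attained t
      ... | s , t≤s , _ , e with NP.m≤n⇒m<n∨m≡n t≤s
      ... | inj₂ refl = e
      ... | inj₁ t<s = ⊥-elim (ZP.<-irrefl refl (ZP.<-≤-trans h (ZP.≤-trans (low≤W s (suc t) t<s) (ZP.≤-trans (ZP.≤-reflexive (sym e)) (low≤W-self t)))))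
      up : b t ≡ true
      up = W<W-suc⇒up t (ZP.<-≤-trans h (low≤W-self (suc t)))
      low-suc≡ : low (suc t) ≡ W t Z.+ 1ℤ
      low-suc≡ = ZP.≤-antisym (ZP.≤-trans (low≤W-self (suc t)) (W-suc≤W+1 t)) (<⇒+1≤ h)

    ¬Star⇒low-suc≡low : ∀ t → ¬ Star t → low (suc t) ≡ low t
    ¬Star⇒low-suc≡low t h = ZP.≤-antisym ≤ (low-mono t (suc t) (NP.n≤1+n t))
      where
      ≤ : low (suc t) Z.≤ low t
      ≤ with low-attained t
      ... | s , t≤s , _ , e with NP.m≤n⇒m<n∨m≡n t≤s
      ... | inj₂ refl = subst (low (suc t) Z.≤_) (sym e) (ZP.≮⇒≥ h)
      ... | inj₁ t<s = subst (low (suc t) Z.≤_) (sym e) (low≤W s (suc t) t<s)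

    private
      module Search≤ (v : ℤ) = BoundedSearch (λ s → W s ZP.≤? v)
      module Search< (v : ℤ) = BoundedSearch (λ s → W s ZP.<? v)

    -- A down step at e closes the first return that starts at the last visit of level W (e + 1).
    down⇒ends-first-return : ∀ e → n N.≤ e → b e ≡ false →
                             Σ ℕ λ t → t N.≤ e × e N.< n N.+ t × FirstReturn t (suc e N.∸ t)
    down⇒ends-first-return e n≤e down = from-last (Search≤.greatest v (suc e N.∸ n) e start≤e W-start≤v)
      where
      v : ℤ
      v = W (suc e)
      start+n : suc e N.∸ n N.+ n ≡ suc e
      start+n = NP.m∸n+n≡m (NP.m≤n⇒m≤1+n n≤e)
      start≤e : suc e N.∸ n N.≤ e
      start≤e = NP.≤-pred (subst (suc e N.∸ n N.<_) start+n (NP.m<m+n _ (s≤s z≤n)))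
      W-start≤v : W (suc e N.∸ n) Z.≤ v
      W-start≤v = subst (W (suc e N.∸ n) Z.≤_) (cong W start+n) (W≤W+period (suc e N.∸ n))
      from-last : BoundedSearch.Greatest (λ s → W s ZP.≤? v) (suc e N.∸ n) e →
                  Σ ℕ λ t → t N.≤ e × e N.< n N.+ t × FirstReturn t (suc e N.∸ t)
      from-last (t , start≤t , t≤e , Wt≤v , last) = t , t≤e , e<n+t , NP.m<n⇒0<n∸m (s≤s t≤e) , return , above
        where
        t<e : t N.< e
        t<e = [ (λ lt → lt) , (λ t≡e → ⊥-elim (ZP.<-irrefl refl (ZP.<-≤-trans (down⇒W-suc<W e down) (subst (λ u → W u Z.≤ v) t≡e Wt≤v)))) ]′ (NP.m≤n⇒m<n∨m≡n t≤e)
        L+t : suc e N.∸ t N.+ t ≡ suc e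
        L+t = NP.m∸n+n≡m (NP.m≤n⇒m≤1+n t≤e)
        above-v : ∀ s → t N.< s → s N.≤ e → v Z.< W s
        above-v s t<s s≤e = ZP.≰⇒> (last s t<s s≤e)
        Wt≡v : W t ≡ v
        Wt≡v = ≤∧<-suc⇒≡ t v Wt≤v (above-v (suc t) NP.≤-refl t<e)
        e<n+t : e N.< n N.+ t
        e<n+t = subst (N._≤ n N.+ t) (trans (NP.+-comm n (suc e N.∸ n)) start+n) (NP.+-monoʳ-≤ n start≤t)
        return : W (suc e N.∸ t N.+ t) ≡ W t
        return = trans (cong W L+t) (sym Wt≡v)
        above : ∀ s → t N.< s → s N.< suc e N.∸ t N.+ t → W t Z.< W s
        above s t<s s< = subst (Z._< W s) (sym Wt≡v) (above-v s t<s (NP.≤-pred (subst (s N.<_) L+t s<)))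

    -- The enclosing return runs from the last point below W r before r to the first one after e.
    dip⇒enclosing-first-return : ∀ r L s → n N.≤ r → FirstReturn r L → L N.+ r N.< s → W s Z.< W r →
                                 Σ ℕ λ a → Σ ℕ λ u → a N.< r × L N.+ r N.< u × u N.≤ n N.+ a × FirstReturn a (u N.∸ a)
    dip⇒enclosing-first-return r L s n≤r (1≤L , return , inside) e<s dip =
      from-first (Search<.least (W r) (suc e) s e<s dip)
      where
      e : ℕ
      e = L N.+ r
      r≤e : r N.≤ e
      r≤e = NP.m≤n+m r L
      Enclosing : Set
      Enclosing = Σ ℕ λ a → Σ ℕ λ u → a N.< r × L N.+ r N.< u × u N.≤ n N.+ a × FirstReturn a (u N.∸ a)
      from-first : BoundedSearch.Least (λ s → W s ZP.<? W r) (suc e) s → Enclosing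
      from-first (u , e<u , _ , Wu<Wr , first) = from-last (Search<.greatest (W r) (u N.∸ n) (r N.∸ 1) lo≤r-1 W-lo<Wr)
        where
        at-least : ∀ t → r N.≤ t → t N.< u → W r Z.≤ W t
        at-least t r≤t t<u with t NP.<? e
        ... | no t≮e = [ (λ e<t → ZP.≮⇒≥ (first t e<t t<u)) , (λ e≡t → ZP.≤-reflexive (trans (sym return) (cong W e≡t))) ]′
                          (NP.m≤n⇒m<n∨m≡n (NP.≮⇒≥ t≮e))
        ... | yes t<e = [ (λ r<t → ZP.<⇒≤ (inside t r<t t<e)) , (λ r≡t → ZP.≤-reflexive (cong W r≡t)) ]′ (NP.m≤n⇒m<n∨m≡n r≤t)
        r<u : r N.< u
        r<u = NP.≤-<-trans r≤e e<u
        u-1+1 : suc (u N.∸ 1) ≡ u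
        u-1+1 = trans (NP.+-comm 1 (u N.∸ 1)) (NP.m∸n+n≡m (NP.≤-trans (s≤s z≤n) r<u))
        Wu+1≡Wr : W u Z.+ 1ℤ ≡ W r
        Wu+1≡Wr = <∧≤+1⇒≡+1 Wu<Wr (ZP.≤-trans (at-least (u N.∸ 1) (NP.≤-pred (subst (r N.<_) (sym u-1+1) r<u)) (subst (u N.∸ 1 N.<_) u-1+1 NP.≤-refl))
                                              (subst (λ w → W (u N.∸ 1) Z.≤ W w Z.+ 1ℤ) u-1+1 (W≤W-suc+1 (u N.∸ 1))))
        lo : ℕ
        lo = u N.∸ n
        lo+n : lo N.+ n ≡ u
        lo+n = NP.m∸n+n≡m (NP.≤-trans n≤r (NP.<⇒≤ r<u))
        W-lo<Wr : W lo Z.< W r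
        W-lo<Wr = ZP.≤-<-trans (subst (W lo Z.≤_) (cong W lo+n) (W≤W+period lo)) Wu<Wr
        lo<r : lo N.< r
        lo<r with lo NP.<? r
        ... | yes lo<r = lo<r
        ... | no lo≮r = ⊥-elim (ZP.<-irrefl refl (ZP.<-≤-trans W-lo<Wr (at-least lo (NP.≮⇒≥ lo≮r) (subst (lo N.<_) lo+n (NP.m<m+n lo (s≤s z≤n))))))
        r-1+1 : suc (r N.∸ 1) ≡ r
        r-1+1 = trans (NP.+-comm 1 (r N.∸ 1)) (NP.m∸n+n≡m (NP.≤-trans (s≤s z≤n) lo<r))
        lo≤r-1 : lo N.≤ r N.∸ 1
        lo≤r-1 = NP.≤-pred (subst (lo N.<_) (sym r-1+1) lo<r)
        from-last : BoundedSearch.Greatest (λ s → W s ZP.<? W r) lo (r N.∸ 1) → Enclosing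
        from-last (a , lo≤a , a≤r-1 , Wa<Wr , last) = a , u , a<r , e<u , u≤n+a , NP.m<n⇒0<n∸m a<u , returns , above
          where
          a<r : a N.< r
          a<r = subst (a N.<_) r-1+1 (s≤s a≤r-1)
          a<u : a N.< u
          a<u = NP.<-trans a<r r<u
          at-least-after-a : ∀ t → a N.< t → t N.< u → W r Z.≤ W t
          at-least-after-a t a<t t<u with t NP.<? r
          ... | yes t<r = ZP.≮⇒≥ (last t a<t (NP.≤-pred (subst (suc t N.≤_) (sym r-1+1) t<r)))
          ... | no t≮r = at-least t (NP.≮⇒≥ t≮r) t<u
          Wa+1≡Wr : W a Z.+ 1ℤ ≡ W r
          Wa+1≡Wr = <∧≤+1⇒≡+1 Wa<Wr (ZP.≤-trans (at-least-after-a (suc a) NP.≤-refl (NP.≤-<-trans a<r r<u)) (W-suc≤W+1 a))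
          L′+a : u N.∸ a N.+ a ≡ u
          L′+a = NP.m∸n+n≡m (NP.<⇒≤ a<u)
          u≤n+a : u N.≤ n N.+ a
          u≤n+a = subst (N._≤ n N.+ a) (trans (NP.+-comm n lo) lo+n) (NP.+-monoʳ-≤ n lo≤a)
          returns : W (u N.∸ a N.+ a) ≡ W a
          returns = trans (cong W L′+a) (+1-injective (trans Wu+1≡Wr (sym Wa+1≡Wr)))
          above : ∀ t → a N.< t → t N.< u N.∸ a N.+ a → W a Z.< W t
          above t a<t t< = ZP.<-≤-trans (+1≤⇒< (ZP.≤-reflexive Wa+1≡Wr)) (at-least-after-a t a<t (subst (t N.<_) L′+a t<))

-- Sums over windows

≤ᵇ-true : ∀ {a t} → a N.≤ t → (a N.≤ᵇ t) ≡ true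
≤ᵇ-true {a} {t} h = dec-true (a NP.≤? t) h

≤ᵇ-false : ∀ {a t} → ¬ (a N.≤ t) → (a N.≤ᵇ t) ≡ false
≤ᵇ-false {a} {t} h = dec-false (a NP.≤? t) h

∑<-zero : ∀ N → ∑< (λ _ → 0ℤ) N ≡ 0ℤ
∑<-zero zero = refl
∑<-zero (suc N) = trans (ZP.+-identityʳ _) (∑<-zero N)

∑<-split : ∀ (g f : ℕ → ℤ) a N → a N.≤ N → (∀ t → a N.≤ t → t N.< N → g t ≡ f t) →
           ∑< g N ≡ ∑< g a Z.+ (∑< f N Z.- ∑< f a)
∑<-split g f a (suc N) a≤sN h with NP.m≤n⇒m<n∨m≡n a≤sN
... | inj₁ a<sN = begin
    ∑< g N Z.+ g N
  ≡⟨ cong₂ Z._+_ (∑<-split g f a N (NP.≤-pred a<sN) (λ t a≤t t<N → h t a≤t (NP.m<n⇒m<1+n t<N))) (h N (NP.≤-pred a<sN) NP.≤-refl) ⟩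
    ∑< g a Z.+ (∑< f N Z.- ∑< f a) Z.+ f N
  ≡⟨ e (∑< g a) (∑< f N) (∑< f a) (f N) ⟩
    ∑< g a Z.+ (∑< f N Z.+ f N Z.- ∑< f a) ∎
  where
  open ≡-Reasoning
  e : ∀ x y z w → x Z.+ (y Z.- z) Z.+ w ≡ x Z.+ (y Z.+ w Z.- z)
  e = solve-∀
∑<-split g f a N a≤N h | inj₂ refl = e (∑< g a) (∑< f a)
  where
  e : ∀ x y → x ≡ x Z.+ (y Z.- y)
  e = solve-∀
∑<-split g f zero zero z≤n h = refl

∑<-vanishing : ∀ (g : ℕ → ℤ) a N → a N.≤ N → (∀ t → a N.≤ t → t N.< N → g t ≡ 0ℤ) → ∑< g N ≡ ∑< g a
∑<-vanishing g a N a≤N h = trans (∑<-split g (λ _ → 0ℤ) a N a≤N h)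
  (trans (cong (λ u → ∑< g a Z.+ (u Z.- ∑< (λ _ → 0ℤ) a)) (∑<-zero N))
         (trans (cong (λ u → ∑< g a Z.+ (0ℤ Z.- u)) (∑<-zero a)) (ZP.+-identityʳ _)))

inWindow inWrappedWindow : ℕ → ℕ → ℕ → Bool
inWindow a c t = (a N.≤ᵇ t) ∧ (t N.≤ᵇ c)
inWrappedWindow a c t = (a N.≤ᵇ t) ∨ (t N.≤ᵇ c)

module WindowSums (f : ℕ → ℤ) where

  restrict : (ℕ → Bool) → ℕ → ℤ
  restrict P t = if P t then f t else 0ℤ

  ∑-window : ∀ a c N → a N.≤ c → c N.< N → ∑< (restrict (inWindow a c)) N ≡ ∑< f (suc c) Z.- ∑< f a
  ∑-window a c N a≤c c<N = begin
      ∑< g N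
    ≡⟨ ∑<-vanishing g (suc c) N c<N (λ t c<t _ → trans (cong (λ u → if (a N.≤ᵇ t) ∧ u then f t else 0ℤ) (≤ᵇ-false (NP.<⇒≱ c<t))) (e₀ (a N.≤ᵇ t))) ⟩
      ∑< g (suc c)
    ≡⟨ ∑<-split g f a (suc c) (NP.m≤n⇒m≤1+n a≤c) (λ t a≤t t≤c → cong₂ (λ u v → if u ∧ v then f t else 0ℤ) (≤ᵇ-true a≤t) (≤ᵇ-true (NP.≤-pred t≤c))) ⟩
      ∑< g a Z.+ (∑< f (suc c) Z.- ∑< f a)
    ≡⟨ cong (Z._+ (∑< f (suc c) Z.- ∑< f a)) (∑<-vanishing g 0 a z≤n (λ t _ t<a → cong (λ u → if u ∧ (t N.≤ᵇ c) then f t else 0ℤ) (≤ᵇ-false (NP.<⇒≱ t<a)))) ⟩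
      0ℤ Z.+ (∑< f (suc c) Z.- ∑< f a)
    ≡⟨ ZP.+-identityˡ _ ⟩
      ∑< f (suc c) Z.- ∑< f a ∎
    where
    open ≡-Reasoning
    g : ℕ → ℤ
    g = restrict (inWindow a c)
    e₀ : ∀ {t} u → (if u ∧ false then f t else 0ℤ) ≡ 0ℤ
    e₀ true = refl
    e₀ false = refl

  ∑-wrapped-window : ∀ a c N → c N.< a → a N.≤ N →
                     ∑< (restrict (inWrappedWindow a c)) N ≡ ∑< f (suc c) Z.+ (∑< f N Z.- ∑< f a)
  ∑-wrapped-window a c N c<a a≤N = begin
      ∑< g N
    ≡⟨ ∑<-split g f a N a≤N (λ t a≤t _ → cong (λ u → if u ∨ (t N.≤ᵇ c) then f t else 0ℤ) (≤ᵇ-true a≤t)) ⟩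
      ∑< g a Z.+ (∑< f N Z.- ∑< f a)
    ≡⟨ cong (Z._+ (∑< f N Z.- ∑< f a)) (∑<-vanishing g (suc c) a c<a
         (λ t c<t t<a → cong₂ (λ u v → if u ∨ v then f t else 0ℤ) (≤ᵇ-false (NP.<⇒≱ t<a)) (≤ᵇ-false (NP.<⇒≱ c<t)))) ⟩
      ∑< g (suc c) Z.+ (∑< f N Z.- ∑< f a)
    ≡⟨ cong (Z._+ (∑< f N Z.- ∑< f a)) (∑<-split g f 0 (suc c) z≤n (λ t _ t≤c → trans (cong (λ u → if (a N.≤ᵇ t) ∨ u then f t else 0ℤ) (≤ᵇ-true (NP.≤-pred t≤c))) (e₁ (a N.≤ᵇ t)))) ⟩
      0ℤ Z.+ (∑< f (suc c) Z.- 0ℤ) Z.+ (∑< f N Z.- ∑< f a)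
    ≡⟨ cong (Z._+ (∑< f N Z.- ∑< f a)) (e₂ (∑< f (suc c))) ⟩
      ∑< f (suc c) Z.+ (∑< f N Z.- ∑< f a) ∎
    where
    open ≡-Reasoning
    g : ℕ → ℤ
    g = restrict (inWrappedWindow a c)
    e₁ : ∀ {t} u → (if u ∨ true then f t else 0ℤ) ≡ f t
    e₁ true = refl
    e₁ false = refl
    e₂ : ∀ x → 0ℤ Z.+ (x Z.- 0ℤ) ≡ x
    e₂ = solve-∀

𝟙 : Bool → ℤ
𝟙 true = 1ℤ
𝟙 false = 0ℤ

∑Fin : ∀ {k} → (Fin k → ℤ) → ℤ
∑Fin {zero} g = 0ℤ
∑Fin {suc k} g = g F.zero Z.+ ∑Fin (λ i → g (F.suc i))

∑Fin-∑< : ∀ {k} (g : Fin k → ℤ) (G : ℕ → ℤ) → (∀ i → g i ≡ G (toℕ i)) → ∑Fin g ≡ ∑< G k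
∑Fin-∑< {zero} g G h = refl
∑Fin-∑< {suc k} g G h = trans (cong₂ Z._+_ (h F.zero) (∑Fin-∑< (λ i → g (F.suc i)) (λ t → G (suc t)) (λ i → h (F.suc i)))) (sym (∑<-suc G k))

∑Fin-cong : ∀ {k} (f g : Fin k → ℤ) → (∀ i → f i ≡ g i) → ∑Fin f ≡ ∑Fin g
∑Fin-cong {zero} f g h = refl
∑Fin-cong {suc k} f g h = cong₂ Z._+_ (h F.zero) (∑Fin-cong _ _ (λ i → h (F.suc i)))

∑Fin-sub : ∀ {k} (f g : Fin k → ℤ) → ∑Fin (λ i → f i Z.- g i) ≡ ∑Fin f Z.- ∑Fin g
∑Fin-sub {zero} f g = refl
∑Fin-sub {suc k} f g = trans (cong (λ u → (f F.zero Z.- g F.zero) Z.+ u) (∑Fin-sub (λ i → f (F.suc i)) (λ i → g (F.suc i))))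
                         (e (f F.zero) (g F.zero) (∑Fin (λ i → f (F.suc i))) (∑Fin (λ i → g (F.suc i))))
  where
  e : ∀ a b c d → a Z.- b Z.+ (c Z.- d) ≡ a Z.+ c Z.- (b Z.+ d)
  e = solve-∀

∣∣-∑Fin : ∀ {k} (p : Subset k) → + ∣ p ∣ ≡ ∑Fin (λ i → 𝟙 (lookup p i))
∣∣-∑Fin [] = refl
∣∣-∑Fin (true ∷ p) = cong (λ u → 1ℤ Z.+ u) (∣∣-∑Fin p)
∣∣-∑Fin (false ∷ p) = trans (∣∣-∑Fin p) (sym (ZP.+-identityˡ _))

lookup-─ : ∀ {k} (p q : Subset k) i → lookup (p ─ q) i ≡ (lookup p i ∧ not (lookup q i))
lookup-─ (true ∷ p) (true ∷ q) F.zero = refl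
lookup-─ (false ∷ p) (true ∷ q) F.zero = refl
lookup-─ (true ∷ p) (false ∷ q) F.zero = refl
lookup-─ (false ∷ p) (false ∷ q) F.zero = refl
lookup-─ (a ∷ p) (c ∷ q) (F.suc i) = lookup-─ p q i

balance-∑Fin : ∀ {k} (x I : Subset k) → balance x I ≡ ∑Fin (λ i → if lookup I i then step (lookup x i) else 0ℤ)
balance-∑Fin x I = begin
    + ∣ x ∩ I ∣ Z.- + ∣ I ─ x ∣
  ≡⟨ cong₂ Z._-_ (∣∣-∑Fin (x ∩ I)) (∣∣-∑Fin (I ─ x)) ⟩
    ∑Fin (λ i → 𝟙 (lookup (x ∩ I) i)) Z.- ∑Fin (λ i → 𝟙 (lookup (I ─ x) i))
  ≡⟨ sym (∑Fin-sub (λ i → 𝟙 (lookup (x ∩ I) i)) (λ i → 𝟙 (lookup (I ─ x) i))) ⟩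
    ∑Fin (λ i → 𝟙 (lookup (x ∩ I) i) Z.- 𝟙 (lookup (I ─ x) i))
  ≡⟨ ∑Fin-cong _ _ pointwise ⟩
    ∑Fin (λ i → if lookup I i then step (lookup x i) else 0ℤ) ∎
  where
  open ≡-Reasoning
  bits : ∀ a c → 𝟙 (a ∧ c) Z.- 𝟙 (c ∧ not a) ≡ (if c then step a else 0ℤ)
  bits true true = refl
  bits true false = refl
  bits false true = refl
  bits false false = refl
  pointwise : ∀ i → 𝟙 (lookup (x ∩ I) i) Z.- 𝟙 (lookup (I ─ x) i) ≡ (if lookup I i then step (lookup x i) else 0ℤ)
  pointwise i rewrite VP.lookup-zipWith _∧_ i x I | lookup-─ I x i = bits (lookup x i) (lookup I i)

∣∣-∑Fin-if : ∀ {k} (I : Subset k) → + ∣ I ∣ ≡ ∑Fin (λ i → if lookup I i then 1ℤ else 0ℤ)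
∣∣-∑Fin-if I = trans (∣∣-∑Fin I) (∑Fin-cong _ _ (λ i → bit (lookup I i)))
  where
  bit : ∀ c → 𝟙 c ≡ (if c then 1ℤ else 0ℤ)
  bit true = refl
  bit false = refl


-- Linear and circular signatures

module _ {n : ℕ} (z : Subset n) (i : Fin n) where

  LinMatch₁ LinMatch₀ CycMatch₁ CycMatch₀ : Set
  LinMatch₁ = ∃ λ j → (i F.< j) × (c z i j ≡ + 0)
  LinMatch₀ = ∃ λ j → (j F.< i) × (c z j i ≡ + 0)
  CycMatch₁ = ∃ λ j → c′ z i j ≡ + 0
  CycMatch₀ = ∃ λ j → c′ z j i ≡ + 0

  linMatch₁? : Dec LinMatch₁
  linMatch₁? = FP.any? (λ j → (i FP.<? j) ×-dec (c z i j ZP.≟ + 0))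

  linMatch₀? : Dec LinMatch₀
  linMatch₀? = FP.any? (λ j → (j FP.<? i) ×-dec (c z j i ZP.≟ + 0))

  cycMatch₁? : Dec CycMatch₁
  cycMatch₁? = FP.any? (λ j → c′ z i j ZP.≟ + 0)

  cycMatch₀? : Dec CycMatch₀
  cycMatch₀? = FP.any? (λ j → c′ z j i ZP.≟ + 0)

  sg≡s1 : i ∈ z → LinMatch₁ → sg z i ≡ s1
  sg≡s1 iz h rewrite dec-true (i ∈? z) iz | dec-true linMatch₁? h = refl

  sg∈≡s* : i ∈ z → ¬ LinMatch₁ → sg z i ≡ s*
  sg∈≡s* iz h rewrite dec-true (i ∈? z) iz | dec-false linMatch₁? h = refl

  sg≡s0 : i ∉ z → LinMatch₀ → sg z i ≡ s0
  sg≡s0 iz h rewrite dec-false (i ∈? z) iz | dec-true linMatch₀? h = refl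

  sg∉≡s* : i ∉ z → ¬ LinMatch₀ → sg z i ≡ s*
  sg∉≡s* iz h rewrite dec-false (i ∈? z) iz | dec-false linMatch₀? h = refl

  csg≡s1 : i ∈ z → CycMatch₁ → csg z i ≡ s1
  csg≡s1 iz h rewrite dec-true (i ∈? z) iz | dec-true cycMatch₁? h = refl

  csg∈≡s* : i ∈ z → ¬ CycMatch₁ → csg z i ≡ s*
  csg∈≡s* iz h rewrite dec-true (i ∈? z) iz | dec-false cycMatch₁? h = refl

  csg≡s0 : i ∉ z → CycMatch₀ → csg z i ≡ s0
  csg≡s0 iz h rewrite dec-false (i ∈? z) iz | dec-true cycMatch₀? h = refl

  sg-s1⇒∈ : sg z i ≡ s1 → i ∈ z
  sg-s1⇒∈ e with i ∈? z | linMatch₀?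
  ... | yes iz | _ = iz
  ... | no _ | yes _ with () ← e
  ... | no _ | no _ with () ← e

  sg-s0⇒∉ : sg z i ≡ s0 → i ∉ z
  sg-s0⇒∉ e with i ∈? z | linMatch₁?
  ... | no iz | _ = iz
  ... | yes _ | yes _ with () ← e
  ... | yes _ | no _ with () ← e

  sg-s*⇒ : sg z i ≡ s* → (i ∈ z × ¬ LinMatch₁) ⊎ (i ∉ z × ¬ LinMatch₀)
  sg-s*⇒ e with i ∈? z | linMatch₁? | linMatch₀?
  ... | yes iz | no h | _ = inj₁ (iz , h)
  ... | yes _ | yes _ | _ with () ← e
  ... | no iz | _ | no h = inj₂ (iz , h)
  ... | no _ | _ | yes _ with () ← e

  sg-∈ : i ∈ z → (sg z i ≡ s1) ⊎ (sg z i ≡ s*)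
  sg-∈ iz = cases linMatch₁?
    where
    cases : Dec LinMatch₁ → (sg z i ≡ s1) ⊎ (sg z i ≡ s*)
    cases (yes h) = inj₁ (sg≡s1 iz h)
    cases (no h) = inj₂ (sg∈≡s* iz h)

  sg-∉ : i ∉ z → (sg z i ≡ s0) ⊎ (sg z i ≡ s*)
  sg-∉ iz = cases linMatch₀?
    where
    cases : Dec LinMatch₀ → (sg z i ≡ s0) ⊎ (sg z i ≡ s*)
    cases (yes h) = inj₁ (sg≡s0 iz h)
    cases (no h) = inj₂ (sg∉≡s* iz h)

  csg-s1⇒ : csg z i ≡ s1 → i ∈ z × CycMatch₁
  csg-s1⇒ e with i ∈? z | cycMatch₁? | cycMatch₀?
  ... | yes iz | yes h | _ = iz , h
  ... | yes _ | no _ | _ with () ← e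
  ... | no _ | _ | yes _ with () ← e
  ... | no _ | _ | no _ with () ← e

  csg-s*⇒ : csg z i ≡ s* → (i ∈ z × ¬ CycMatch₁) ⊎ (i ∉ z × ¬ CycMatch₀)
  csg-s*⇒ e with i ∈? z | cycMatch₁? | cycMatch₀?
  ... | yes iz | no h | _ = inj₁ (iz , h)
  ... | yes _ | yes _ | _ with () ← e
  ... | no iz | _ | no h = inj₂ (iz , h)
  ... | no _ | _ | yes _ with () ← e

  csg-∈ : i ∈ z → (csg z i ≡ s1) ⊎ (csg z i ≡ s*)
  csg-∈ iz = cases cycMatch₁?
    where
    cases : Dec CycMatch₁ → (csg z i ≡ s1) ⊎ (csg z i ≡ s*)
    cases (yes h) = inj₁ (csg≡s1 iz h)
    cases (no h) = inj₂ (csg∈≡s* iz h)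

sg-∈-cong : ∀ {n} (z z′ : Subset n) {i} → i ∈ z → i ∈ z′ →
            (LinMatch₁ z i → LinMatch₁ z′ i) → (LinMatch₁ z′ i → LinMatch₁ z i) → sg z i ≡ sg z′ i
sg-∈-cong z z′ {i} iz iz′ to from = cases (linMatch₁? z i)
  where
  cases : Dec (LinMatch₁ z i) → sg z i ≡ sg z′ i
  cases (yes h) = trans (sg≡s1 z i iz h) (sym (sg≡s1 z′ i iz′ (to h)))
  cases (no h) = trans (sg∈≡s* z i iz h) (sym (sg∈≡s* z′ i iz′ (λ h′ → h (from h′))))

sg-∉-cong : ∀ {n} (z z′ : Subset n) {i} → i ∉ z → i ∉ z′ →
            (LinMatch₀ z i → LinMatch₀ z′ i) → (LinMatch₀ z′ i → LinMatch₀ z i) → sg z i ≡ sg z′ i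
sg-∉-cong z z′ {i} iz iz′ to from = cases (linMatch₀? z i)
  where
  cases : Dec (LinMatch₀ z i) → sg z i ≡ sg z′ i
  cases (yes h) = trans (sg≡s0 z i iz h) (sym (sg≡s0 z′ i iz′ (to h)))
  cases (no h) = trans (sg∉≡s* z i iz h) (sym (sg∉≡s* z′ i iz′ (λ h′ → h (from h′))))

∈─⁻ : ∀ {k} (p q : Subset k) {i} → i ∈ p ─ q → i ∈ p × i ∉ q
∈─⁻ (true ∷ p) (false ∷ q) here = here , λ ()
∈─⁻ (false ∷ p) (true ∷ q) {F.zero} ()
∈─⁻ (false ∷ p) (false ∷ q) {F.zero} ()
∈─⁻ (_ ∷ p) (_ ∷ q) (there h) with ∈─⁻ p q h
... | ip , iq = there ip , λ { (there h′) → iq h′ }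

∈-⁻ : ∀ {k} (p : Subset k) a {i} → i ∈ p - a → i ∈ p × i ≢ a
∈-⁻ p a h with ∈─⁻ p ⁅ a ⁆ h
... | ip , ia = ip , λ { refl → ia (x∈⁅x⁆ a) }

a∉p-a : ∀ {k} (p : Subset k) a → a ∉ p - a
a∉p-a p a h = proj₂ (∈-⁻ p a h) refl

⊆∧∣∣≤⇒≡ : ∀ {k} {p q : Subset k} → q ⊆ p → ∣ p ∣ N.≤ ∣ q ∣ → q ≡ p
⊆∧∣∣≤⇒≡ {p = p} {q} q⊆p ∣p∣≤∣q∣ = ⊆-antisym q⊆p p⊆q
  where
  p⊆q : p ⊆ q
  p⊆q {i} ip with i ∈? q
  ... | yes iq = iq
  ... | no ¬iq = ⊥-elim (NP.<⇒≱ (p⊂q⇒∣p∣<∣q∣ (q⊆p , i , ip , ¬iq)) ∣p∣≤∣q∣)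

∣p∣≡1+∣p-a∣ : ∀ {k} (p : Subset k) a → a ∈ p → ∣ p ∣ ≡ suc ∣ p - a ∣
∣p∣≡1+∣p-a∣ = go
  where
  go : ∀ {k} (p : Subset k) a → a ∈ p → ∣ p ∣ ≡ suc ∣ p - a ∣
  go (true ∷ p) F.zero here = cong suc (cong ∣_∣ (sym (p─⊥≡p p)))
  go (true ∷ p) (F.suc a) (there h) = cong suc (go p a h)
  go (false ∷ p) (F.suc a) (there h) = go p a h

∪⁅⁆-minus : ∀ {k} (y : Subset k) b → b ∉ y → (y ∪ ⁅ b ⁆) - b ≡ y
∪⁅⁆-minus y b b∉y = ⊆-antisym ⊆y y⊆
  where
  ⊆y : (y ∪ ⁅ b ⁆) - b ⊆ y
  ⊆y h with ∈-⁻ (y ∪ ⁅ b ⁆) b h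
  ... | i∈ , i≢b = [ (λ iy → iy) , (λ ib → ⊥-elim (i≢b (x∈⁅y⁆⇒x≡y b ib))) ]′ (x∈p∪q⁻ y ⁅ b ⁆ i∈)
  y⊆ : y ⊆ (y ∪ ⁅ b ⁆) - b
  y⊆ iy = x∈p∧x≢y⇒x∈p-y (x∈p∪q⁺ (inj₁ iy)) (λ { refl → b∉y iy })

minus-∪⁅⁆ : ∀ {k} (x : Subset k) b → b ∈ x → (x - b) ∪ ⁅ b ⁆ ≡ x
minus-∪⁅⁆ x b b∈x = ⊆-antisym ⊆x x⊆
  where
  ⊆x : (x - b) ∪ ⁅ b ⁆ ⊆ x
  ⊆x h = [ (λ i∈ → proj₁ (∈-⁻ x b i∈)) , (λ ib → subst (_∈ x) (sym (x∈⁅y⁆⇒x≡y b ib)) b∈x) ]′ (x∈p∪q⁻ (x - b) ⁅ b ⁆ h)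
  x⊆ : x ⊆ (x - b) ∪ ⁅ b ⁆
  x⊆ {i} ix with i F.≟ b
  ... | yes refl = x∈p∪q⁺ (inj₂ (x∈⁅x⁆ b))
  ... | no i≢b = x∈p∪q⁺ (inj₁ (x∈p∧x≢y⇒x∈p-y ix i≢b))

∸-cancelʳ-< : ∀ {c a b} → c N.≤ a → c N.≤ b → a N.∸ c N.< b N.∸ c → a N.< b
∸-cancelʳ-< {c} c≤a c≤b h = subst₂ N._<_ (NP.m∸n+n≡m c≤a) (NP.m∸n+n≡m c≤b) (NP.+-monoˡ-< c h)

0<∸⇒< : ∀ {c a} → 0 N.< a N.∸ c → c N.< a
0<∸⇒< {c} {a} h = NP.m∸n≢0⇒n<m (λ e → NP.<-irrefl (sym e) h)

module _ {K k : ℕ} (f : Fin K → Fin k) (mono : ∀ u v → u F.< v → f u F.< f v) where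

  monotone⇒reflects-< : ∀ v w → toℕ (f v) N.< toℕ (f w) → toℕ v N.< toℕ w
  monotone⇒reflects-< v w h with NP.<-cmp (toℕ v) (toℕ w)
  ... | tri< lt _ _ = lt
  ... | tri≈ _ eq _ = ⊥-elim (NP.<-irrefl (cong (λ u → toℕ (f u)) (FP.toℕ-injective eq)) h)
  ... | tri> _ _ gt = ⊥-elim (NP.<-asym h (mono w v gt))

  monotone⇒injective : ∀ v w → f v ≡ f w → v ≡ w
  monotone⇒injective v w e with NP.<-cmp (toℕ v) (toℕ w)
  ... | tri< lt _ _ = ⊥-elim (NP.<-irrefl (cong toℕ e) (mono v w lt))
  ... | tri≈ _ eq _ = FP.toℕ-injective eq
  ... | tri> _ _ gt = ⊥-elim (NP.<-irrefl (cong toℕ (sym e)) (mono w v gt))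

double-injective : ∀ a c → a N.+ a ≡ c N.+ c → a ≡ c
double-injective a c e = NP.*-cancelˡ-≡ a c 2 (trans (cong (a N.+_) (NP.+-identityʳ a)) (trans e (sym (cong (c N.+_) (NP.+-identityʳ c)))))

is-s1 : Sym → Bool
is-s1 s1 = true
is-s1 s0 = false
is-s1 s* = false

is-s1⇒≡s1 : ∀ s → is-s1 s ≡ true → s ≡ s1
is-s1⇒≡s1 s1 _ = refl

-- Positions modulo n and the walk of a subset

module Cyclic (m : ℕ) where

  n : ℕ
  n = suc m

  pos : ℕ → Fin n
  pos t = t mod n

  toℕ-pos : ∀ t → toℕ (pos t) ≡ t % n
  toℕ-pos t = FP.toℕ-fromℕ< (m%n<n t n)

  pos-toℕ : ∀ (k : Fin n) → pos (toℕ k) ≡ k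
  pos-toℕ k = FP.toℕ-injective (trans (toℕ-pos (toℕ k)) (m<n⇒m%n≡m (FP.toℕ<n k)))

  pos-+n : ∀ t → pos (t N.+ n) ≡ pos t
  pos-+n t = FP.toℕ-injective (trans (toℕ-pos (t N.+ n)) (trans ([m+n]%n≡m%n t n) (sym (toℕ-pos t))))

  pos-+n-toℕ : ∀ (k : Fin n) → pos (toℕ k N.+ n) ≡ k
  pos-+n-toℕ k = trans (pos-+n (toℕ k)) (pos-toℕ k)

  bits : Subset n → ℕ → Bool
  bits z t = lookup z (pos t)

  bits-periodic : ∀ z t → bits z (t N.+ n) ≡ bits z t
  bits-periodic z t = cong (lookup z) (pos-+n t)

  module WalkOf (z : Subset n) = PeriodicWalk (bits z) m (bits-periodic z)

  bits-toℕ : ∀ z (k : Fin n) → bits z (toℕ k) ≡ lookup z k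
  bits-toℕ z k = cong (lookup z) (pos-toℕ k)

  -- clockwise distance from i to t, for i, t < n
  offsetℕ : ℕ → ℕ → ℕ
  offsetℕ i t = if i N.≤ᵇ t then t N.∸ i else (t N.+ n) N.∸ i

  offsetℕ-≤ : ∀ {i t} → i N.≤ t → offsetℕ i t ≡ t N.∸ i
  offsetℕ-≤ h rewrite ≤ᵇ-true h = refl

  offsetℕ-> : ∀ {i t} → t N.< i → offsetℕ i t ≡ (t N.+ n) N.∸ i
  offsetℕ-> {i} {t} h rewrite ≤ᵇ-false {i} {t} (NP.<⇒≱ h) = refl

  offsetℕ<n : ∀ i t → t N.< n → offsetℕ i t N.< n
  offsetℕ<n i t t<n with i NP.≤? t
  ... | yes i≤t rewrite offsetℕ-≤ i≤t = NP.≤-<-trans (NP.m∸n≤m t i) t<n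
  ... | no i≰t rewrite offsetℕ-> {i} {t} (NP.≰⇒> i≰t) = NP.m<n+o⇒m∸n<o (t N.+ n) i (NP.+-monoˡ-< n (NP.≰⇒> i≰t))

  offsetℕ-back : ∀ i t → i N.< n → t N.< n → (offsetℕ i t N.+ i) % n ≡ t
  offsetℕ-back i t i<n t<n with i NP.≤? t
  ... | yes i≤t rewrite offsetℕ-≤ i≤t | NP.m∸n+n≡m i≤t = m<n⇒m%n≡m t<n
  ... | no i≰t rewrite offsetℕ-> {i} {t} (NP.≰⇒> i≰t) | NP.m∸n+n≡m {t N.+ n} {i} (NP.≤-trans (NP.<⇒≤ i<n) (NP.m≤n+m n t)) =
    trans ([m+n]%n≡m%n t n) (m<n⇒m%n≡m t<n)

  offsetℕ-fwd : ∀ i d → i N.< n → d N.< n → offsetℕ i ((d N.+ i) % n) ≡ d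
  offsetℕ-fwd i d i<n d<n with (d N.+ i) NP.<? n
  ... | yes lt rewrite m<n⇒m%n≡m lt = trans (offsetℕ-≤ (NP.m≤n+m i d)) (NP.m+n∸n≡m d i)
  ... | no ge = trans (cong (offsetℕ i) wrapped) (trans (offsetℕ-> {i} {(d N.+ i) N.∸ n} below-i) back)
    where
    n≤d+i : n N.≤ d N.+ i
    n≤d+i = NP.≮⇒≥ ge
    wrapped : (d N.+ i) % n ≡ (d N.+ i) N.∸ n
    wrapped = trans (sym (m≤n⇒[n∸m]%m≡n%m n≤d+i)) (m<n⇒m%n≡m (NP.m<n+o⇒m∸n<o (d N.+ i) n (NP.+-mono-< d<n i<n)))
    below-i : (d N.+ i) N.∸ n N.< i
    below-i = NP.+-cancelʳ-< n _ i (subst (N._< i N.+ n) (sym (NP.m∸n+n≡m n≤d+i)) (subst (N._< i N.+ n) (NP.+-comm i d) (NP.+-monoʳ-< i d<n)))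
    back : ((d N.+ i) N.∸ n N.+ n) N.∸ i ≡ d
    back rewrite NP.m∸n+n≡m n≤d+i = NP.m+n∸n≡m d i

  offset : Fin n → Fin n → ℕ
  offset i j = offsetℕ (toℕ i) (toℕ j)

  offset<n : ∀ i j → offset i j N.< n
  offset<n i j = offsetℕ<n (toℕ i) (toℕ j) (FP.toℕ<n j)

  offset-self : ∀ i → offset i i ≡ 0
  offset-self i = trans (offsetℕ-≤ {toℕ i} NP.≤-refl) (NP.n∸n≡0 (toℕ i))

  %-+-absorb : ∀ d r → d N.< n → (d N.+ r) % n ≡ (d N.+ r % n) % n
  %-+-absorb d r d<n = trans (%-distribˡ-+ d r n) (cong (λ u → (u N.+ r % n) % n) (m<n⇒m%n≡m d<n))

  offset-pos : ∀ r d → d N.< n → offset (pos r) (pos (d N.+ r)) ≡ d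
  offset-pos r d d<n rewrite toℕ-pos r | toℕ-pos (d N.+ r) | %-+-absorb d r d<n = offsetℕ-fwd (r % n) d (m%n<n r n) d<n

  pos-offset : ∀ r (j : Fin n) → pos (offset (pos r) j N.+ r) ≡ j
  pos-offset r j = FP.toℕ-injective (trans (toℕ-pos (offset (pos r) j N.+ r)) (trans (%-+-absorb (offset (pos r) j) r (offset<n (pos r) j))
                     (subst (λ u → (offsetℕ u (toℕ j) N.+ r % n) % n ≡ toℕ j) (sym (toℕ-pos r)) (offsetℕ-back (r % n) (toℕ j) (m%n<n r n) (FP.toℕ<n j)))))

  inCInterval : ℕ → ℕ → ℕ → Bool
  inCInterval a c = if a N.≤ᵇ c then inWindow a c else inWrappedWindow a c

  lookup-cinterval : ∀ (i j k : Fin n) → lookup (cinterval i j) k ≡ inCInterval (toℕ i) (toℕ j) (toℕ k)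
  lookup-cinterval i j k with toℕ i N.≤ᵇ toℕ j
  ... | true = VP.lookup∘tabulate (λ t → does (i F.≤? t) ∧ does (t F.≤? j)) k
  ... | false = VP.lookup∘tabulate (λ t → does (i F.≤? t) ∨ does (t F.≤? j)) k

  ∑-cinterval : ∀ (f : ℕ → ℤ) → (∀ t → ∑< f (t N.+ n) ≡ ∑< f t Z.+ ∑< f n) → ∀ (i j : Fin n) →
                ∑< (λ t → if inCInterval (toℕ i) (toℕ j) t then f t else 0ℤ) n
                  ≡ ∑< f (suc (offset i j) N.+ toℕ i) Z.- ∑< f (toℕ i)
  ∑-cinterval f periodic i j with toℕ i NP.≤? toℕ j
  ... | yes a≤c rewrite ≤ᵇ-true a≤c | NP.m∸n+n≡m a≤c =
    WindowSums.∑-window f (toℕ i) (toℕ j) n a≤c (FP.toℕ<n j)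
  ... | no a≰c rewrite ≤ᵇ-false a≰c | NP.m∸n+n≡m (NP.≤-trans (NP.<⇒≤ (FP.toℕ<n i)) (NP.m≤n+m n (toℕ j))) =
    trans (WindowSums.∑-wrapped-window f (toℕ i) (toℕ j) n (NP.≰⇒> a≰c) (NP.<⇒≤ (FP.toℕ<n i)))
          (trans (e (∑< f (suc (toℕ j))) (∑< f n) (∑< f (toℕ i))) (cong (Z._- ∑< f (toℕ i)) (sym (periodic (suc (toℕ j))))))
    where
    e : ∀ a d w → a Z.+ (d Z.- w) ≡ a Z.+ d Z.- w
    e = solve-∀

  c′≡W-diff : ∀ (z : Subset n) (i j : Fin n) → c′ z i j ≡ WalkOf.W z (suc (offset i j) N.+ toℕ i) Z.- WalkOf.W z (toℕ i)
  c′≡W-diff z i j = trans (balance-∑Fin z (cinterval i j))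
    (trans (∑Fin-∑< _ _ pointwise) (∑-cinterval (λ t → step (bits z t)) (WalkOf.W-period z) i j))
    where
    pointwise : ∀ k → (if lookup (cinterval i j) k then step (lookup z k) else 0ℤ)
                      ≡ (if inCInterval (toℕ i) (toℕ j) (toℕ k) then step (bits z (toℕ k)) else 0ℤ)
    pointwise k rewrite lookup-cinterval i j k | bits-toℕ z k = refl

  ∣cinterval∣ : ∀ (i j : Fin n) → ∣ cinterval i j ∣ ≡ suc (offset i j)
  ∣cinterval∣ i j = ZP.+-injective (begin
      + ∣ cinterval i j ∣
    ≡⟨ ∣∣-∑Fin-if (cinterval i j) ⟩
      ∑Fin (λ k → if lookup (cinterval i j) k then 1ℤ else 0ℤ)
    ≡⟨ ∑Fin-∑< _ _ (λ k → cong (if_then 1ℤ else 0ℤ) (lookup-cinterval i j k)) ⟩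
      ∑< (λ t → if inCInterval (toℕ i) (toℕ j) t then 1ℤ else 0ℤ) n
    ≡⟨ ∑-cinterval (λ _ → 1ℤ) (λ t → trans (∑<-one (t N.+ n)) (trans (ZP.pos-+ t n) (sym (cong₂ Z._+_ (∑<-one t) (∑<-one n))))) i j ⟩
      ∑< (λ _ → 1ℤ) (suc (offset i j) N.+ toℕ i) Z.- ∑< (λ _ → 1ℤ) (toℕ i)
    ≡⟨ cong₂ Z._-_ (trans (∑<-one _) (ZP.pos-+ (suc (offset i j)) (toℕ i))) (∑<-one (toℕ i)) ⟩
      + suc (offset i j) Z.+ + toℕ i Z.- + toℕ i
    ≡⟨ e (+ suc (offset i j)) (+ toℕ i) ⟩
      + suc (offset i j) ∎)
    where
    open ≡-Reasoning
    e : ∀ x y → x Z.+ y Z.- y ≡ x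
    e = solve-∀

  c≡W-diff : ∀ (z : Subset n) (i j : Fin n) → toℕ i N.≤ toℕ j → c z i j ≡ WalkOf.W z (suc (toℕ j)) Z.- WalkOf.W z (toℕ i)
  c≡W-diff z i j i≤j = trans (balance-∑Fin z (interval i j))
    (trans (∑Fin-∑< _ _ pointwise) (WindowSums.∑-window (λ t → step (bits z t)) (toℕ i) (toℕ j) n i≤j (FP.toℕ<n j)))
    where
    pointwise : ∀ k → (if lookup (interval i j) k then step (lookup z k) else 0ℤ)
                      ≡ WindowSums.restrict (λ t → step (bits z t)) (inWindow (toℕ i) (toℕ j)) (toℕ k)
    pointwise k rewrite VP.lookup∘tabulate (λ t → does (i F.≤? t) ∧ does (t F.≤? j)) k | bits-toℕ z k = refl

  private
    ≤ᵇ⇒≤ : ∀ {a b} → (a N.≤ᵇ b) ≡ true → a N.≤ b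
    ≤ᵇ⇒≤ {a} {b} h = NP.≤ᵇ⇒≤ a b (subst T (sym h) _)

    inCInterval⇒offset≤ : ∀ a c t → a N.< n → c N.< n → t N.< n → inCInterval a c t ≡ true → offsetℕ a t N.≤ offsetℕ a c
    inCInterval⇒offset≤ a c t a<n c<n t<n h with a NP.≤? c | a NP.≤? t
    ... | yes a≤c | yes a≤t rewrite ≤ᵇ-true a≤c | ≤ᵇ-true a≤t = NP.∸-monoˡ-≤ a (≤ᵇ⇒≤ h)
    ... | yes a≤c | no a≰t rewrite ≤ᵇ-true a≤c | ≤ᵇ-false a≰t with () ← h
    ... | no a≰c | yes a≤t rewrite ≤ᵇ-false a≰c | ≤ᵇ-true a≤t = NP.∸-monoˡ-≤ a (NP.≤-trans (NP.<⇒≤ t<n) (NP.m≤n+m n c))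
    ... | no a≰c | no a≰t rewrite ≤ᵇ-false a≰c | ≤ᵇ-false a≰t = NP.∸-monoˡ-≤ a (NP.+-monoˡ-≤ n (≤ᵇ⇒≤ h))

    offset≤⇒inCInterval : ∀ a c t → a N.< n → c N.< n → t N.< n → offsetℕ a t N.≤ offsetℕ a c → inCInterval a c t ≡ true
    offset≤⇒inCInterval a c t a<n c<n t<n h with a NP.≤? c | a NP.≤? t
    ... | yes a≤c | yes a≤t rewrite offsetℕ-≤ a≤c | offsetℕ-≤ a≤t | ≤ᵇ-true a≤c | ≤ᵇ-true a≤t =
      ≤ᵇ-true (subst₂ N._≤_ (NP.m∸n+n≡m a≤t) (NP.m∸n+n≡m a≤c) (NP.+-monoˡ-≤ a h))
    ... | yes a≤c | no a≰t rewrite offsetℕ-≤ a≤c | offsetℕ-> {a} {t} (NP.≰⇒> a≰t) =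
      ⊥-elim (NP.<⇒≱ (NP.∸-monoˡ-< (NP.<-≤-trans c<n (NP.m≤n+m n t)) a≤c) h)
    ... | no a≰c | yes a≤t rewrite ≤ᵇ-false a≰c | ≤ᵇ-true a≤t = refl
    ... | no a≰c | no a≰t rewrite offsetℕ-> {a} {c} (NP.≰⇒> a≰c) | offsetℕ-> {a} {t} (NP.≰⇒> a≰t) | ≤ᵇ-false a≰c | ≤ᵇ-false a≰t =
      ≤ᵇ-true (NP.+-cancelʳ-≤ n t c (subst₂ N._≤_ (NP.m∸n+n≡m (a≤+n t)) (NP.m∸n+n≡m (a≤+n c)) (NP.+-monoˡ-≤ a h)))
      where
      a≤+n : ∀ u → a N.≤ u N.+ n
      a≤+n u = NP.≤-trans (NP.<⇒≤ a<n) (NP.m≤n+m n u)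

  ∈cinterval⇒offset≤ : ∀ (i j k : Fin n) → k ∈ cinterval i j → offset i k N.≤ offset i j
  ∈cinterval⇒offset≤ i j k h = inCInterval⇒offset≤ (toℕ i) (toℕ j) (toℕ k) (FP.toℕ<n i) (FP.toℕ<n j) (FP.toℕ<n k)
    (trans (sym (lookup-cinterval i j k)) (VP.[]=⇒lookup h))

  offset≤⇒∈cinterval : ∀ (i j k : Fin n) → offset i k N.≤ offset i j → k ∈ cinterval i j
  offset≤⇒∈cinterval i j k h = VP.lookup⇒[]= k (cinterval i j)
    (trans (lookup-cinterval i j k) (offset≤⇒inCInterval (toℕ i) (toℕ j) (toℕ k) (FP.toℕ<n i) (FP.toℕ<n j) (FP.toℕ<n k) h))

  start∈cinterval : ∀ (i j : Fin n) → i ∈ cinterval i j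
  start∈cinterval i j = offset≤⇒∈cinterval i j i (subst (N._≤ offset i j) (sym (offset-self i)) z≤n)

  module _ (z : Subset n) where
    open WalkOf z using (W; W-diff-periods; drift; up-never-returns⇒above; FirstReturn; FirstReturn⇒up)

    ∈⇒bit : ∀ r → pos r ∈ z → bits z r ≡ true
    ∈⇒bit r h = VP.[]=⇒lookup h

    bit⇒∈ : ∀ r → bits z r ≡ true → pos r ∈ z
    bit⇒∈ r h = VP.lookup⇒[]= (pos r) z h

    ∉⇒¬bit : ∀ r → pos r ∉ z → bits z r ≡ false
    ∉⇒¬bit r h = cases (bits z r) refl
      where
      cases : ∀ c → bits z r ≡ c → bits z r ≡ false
      cases true eq = ⊥-elim (h (bit⇒∈ r eq))
      cases false eq = eq

    ¬bit⇒∉ : ∀ r → bits z r ≡ false → pos r ∉ z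
    ¬bit⇒∉ r h iz with () ← trans (sym (∈⇒bit r iz)) h

    ∈⇒bit-toℕ : ∀ (i : Fin n) → i ∈ z → bits z (toℕ i) ≡ true
    ∈⇒bit-toℕ i h = trans (bits-toℕ z i) (VP.[]=⇒lookup h)

    bit-toℕ⇒∈ : ∀ (i : Fin n) → bits z (toℕ i) ≡ true → i ∈ z
    bit-toℕ⇒∈ i h = VP.lookup⇒[]= i z (trans (sym (bits-toℕ z i)) h)

    ∉⇒¬bit-toℕ : ∀ (i : Fin n) → i ∉ z → bits z (toℕ i) ≡ false
    ∉⇒¬bit-toℕ i h = ∉⇒¬bit (toℕ i) (λ p → h (subst (_∈ z) (pos-toℕ i) p))

    ¬bit-toℕ⇒∉ : ∀ (i : Fin n) → bits z (toℕ i) ≡ false → i ∉ z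
    ¬bit-toℕ⇒∉ i h p = ¬bit⇒∉ (toℕ i) h (subst (_∈ z) (sym (pos-toℕ i)) p)

    W-diff-mod : ∀ x r → W (x N.+ r % n) Z.- W (r % n) ≡ W (x N.+ r) Z.- W r
    W-diff-mod x r = sym (trans (cong₂ (λ u v → W u Z.- W v) x+r≡ (m≡m%n+[m/n]*n r n)) (W-diff-periods (r / n) (x N.+ r % n) (r % n)))
      where
      x+r≡ : x N.+ r ≡ x N.+ r % n N.+ (r / n) N.* n
      x+r≡ = trans (cong (x N.+_) (m≡m%n+[m/n]*n r n)) (sym (NP.+-assoc x (r % n) _))

    c′-pos≡W-diff : ∀ r d → d N.< n → c′ z (pos r) (pos (d N.+ r)) ≡ W (suc d N.+ r) Z.- W r
    c′-pos≡W-diff r d d<n = trans (c′≡W-diff z (pos r) (pos (d N.+ r)))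
      (trans (cong (λ u → W (suc u N.+ toℕ (pos r)) Z.- W (toℕ (pos r))) (offset-pos r d d<n))
      (trans (cong (λ u → W (suc d N.+ u) Z.- W u) (toℕ-pos r)) (W-diff-mod (suc d) r)))

    c′-pos≡W-diff′ : ∀ r (j : Fin n) → c′ z (pos r) j ≡ W (suc (offset (pos r) j) N.+ r) Z.- W r
    c′-pos≡W-diff′ r j = trans (cong (c′ z (pos r)) (sym (pos-offset r j))) (c′-pos≡W-diff r (offset (pos r) j) (offset<n (pos r) j))

    c′-pos≡0⇒return : ∀ r (j : Fin n) → c′ z (pos r) j ≡ + 0 → W (suc (offset (pos r) j) N.+ r) ≡ W r
    c′-pos≡0⇒return r j e = ZP.i-j≡0⇒i≡j _ _ (trans (sym (c′-pos≡W-diff′ r j)) e)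

    return⇒c′-pos≡0 : ∀ r d → d N.< n → W (suc d N.+ r) ≡ W r → c′ z (pos r) (pos (d N.+ r)) ≡ + 0
    return⇒c′-pos≡0 r d d<n e = trans (c′-pos≡W-diff r d d<n) (ZP.i≡j⇒i-j≡0 e)

    ∣cinterval-pos∣ : ∀ r d → d N.< n → ∣ cinterval (pos r) (pos (d N.+ r)) ∣ ≡ suc d
    ∣cinterval-pos∣ r d d<n = trans (∣cinterval∣ (pos r) (pos (d N.+ r))) (cong suc (offset-pos r d d<n))

    CycMatch₁⇒return : ∀ r → CycMatch₁ z (pos r) → Σ ℕ λ t → r N.< t × t N.≤ n N.+ r × W t ≡ W r
    CycMatch₁⇒return r (j , e) = suc (offset (pos r) j) N.+ r , s≤s (NP.m≤n+m r _) ,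
                                 NP.+-monoˡ-≤ r (offset<n (pos r) j) , c′-pos≡0⇒return r j e

    return⇒CycMatch₁ : ∀ r t → r N.< t → t N.≤ n N.+ r → W t ≡ W r → CycMatch₁ z (pos r)
    return⇒CycMatch₁ r t r<t t≤ e = pos (d N.+ r) , return⇒c′-pos≡0 r d d<n (trans (cong W d+r≡t) e)
      where
      d : ℕ
      d = t N.∸ suc r
      d+r≡t : suc d N.+ r ≡ t
      d+r≡t = trans (sym (NP.+-suc d r)) (NP.m∸n+n≡m r<t)
      d<n : d N.< n
      d<n = NP.+-cancelʳ-< r d n (subst (N._≤ n N.+ r) (sym d+r≡t) t≤)

    LinMatch₁⇒return : ∀ (i : Fin n) → LinMatch₁ z i → Σ ℕ λ t → suc (suc (toℕ i)) N.≤ t × t N.≤ n × W t ≡ W (toℕ i)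
    LinMatch₁⇒return i (j , i<j , e) = suc (toℕ j) , s≤s i<j , FP.toℕ<n j ,
      ZP.i-j≡0⇒i≡j _ _ (trans (sym (c≡W-diff z i j (NP.<⇒≤ i<j))) e)

    return⇒LinMatch₁ : ∀ (i : Fin n) t → suc (suc (toℕ i)) N.≤ t → t N.≤ n → W t ≡ W (toℕ i) → LinMatch₁ z i
    return⇒LinMatch₁ i (suc t) (s≤s i<t) t<n e = pos t , i<pos-t ,
      trans (c≡W-diff z i (pos t) (NP.<⇒≤ i<pos-t)) (ZP.i≡j⇒i-j≡0 (trans (cong (λ u → W (suc u)) toℕ-pos-t) e))
      where
      toℕ-pos-t : toℕ (pos t) ≡ t
      toℕ-pos-t = trans (toℕ-pos t) (m<n⇒m%n≡m t<n)
      i<pos-t : toℕ i N.< toℕ (pos t)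
      i<pos-t = subst (toℕ i N.<_) (sym toℕ-pos-t) i<t

    LinMatch₀⇒visit : ∀ (i : Fin n) → LinMatch₀ z i → Σ ℕ λ t → t N.< toℕ i × W t ≡ W (suc (toℕ i))
    LinMatch₀⇒visit i (j , j<i , e) = toℕ j , j<i , sym (ZP.i-j≡0⇒i≡j _ _ (trans (sym (c≡W-diff z j i (NP.<⇒≤ j<i))) e))

    visit⇒LinMatch₀ : ∀ (i : Fin n) t → t N.< toℕ i → W t ≡ W (suc (toℕ i)) → LinMatch₀ z i
    visit⇒LinMatch₀ i t t<i e = pos t , pos-t<i ,
      trans (c≡W-diff z (pos t) i (NP.<⇒≤ pos-t<i)) (ZP.i≡j⇒i-j≡0 (trans (sym e) (cong W (sym toℕ-pos-t))))
      where
      toℕ-pos-t : toℕ (pos t) ≡ t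
      toℕ-pos-t = trans (toℕ-pos t) (m<n⇒m%n≡m (NP.<-trans t<i (FP.toℕ<n i)))
      pos-t<i : toℕ (pos t) N.< toℕ i
      pos-t<i = subst (N._< toℕ i) (sym toℕ-pos-t) t<i

    IsPr′⇒FirstReturn : ∀ r (j : Fin n) → IsPr′ z (pos r) j → FirstReturn r (suc (offset (pos r) j))
    IsPr′⇒FirstReturn r j (iz , e , minimal) = s≤s z≤n , c′-pos≡0⇒return r j e , above
      where
      d : ℕ
      d = offset (pos r) j
      no-earlier-return : ∀ t → r N.< t → t N.≤ d N.+ r → W t ≢ W r
      no-earlier-return t r<t t≤ eq = NP.<⇒≱ d′<d (NP.≤-pred (subst₂ N._≤_ (∣cinterval∣ (pos r) j) (∣cinterval-pos∣ r d′ d′<n)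
                                        (minimal (pos (d′ N.+ r)) (return⇒c′-pos≡0 r d′ d′<n (trans (cong W t≡) eq)))))
        where
        d′ : ℕ
        d′ = t N.∸ suc r
        t≡ : suc d′ N.+ r ≡ t
        t≡ = trans (sym (NP.+-suc d′ r)) (NP.m∸n+n≡m r<t)
        d′<d : d′ N.< d
        d′<d = NP.+-cancelʳ-< r d′ d (subst (N._≤ d N.+ r) (sym t≡) t≤)
        d′<n : d′ N.< n
        d′<n = NP.<-trans d′<d (offset<n (pos r) j)
      above : ∀ s → r N.< s → s N.< suc d N.+ r → W r Z.< W s
      above s r<s s< = up-never-returns⇒above r (d N.+ r) (∈⇒bit r iz) no-earlier-return s r<s (NP.≤-pred s<)

    FirstReturn⇒IsPr′ : ∀ r d → d N.< n → FirstReturn r (suc d) → IsPr′ z (pos r) (pos (d N.+ r))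
    FirstReturn⇒IsPr′ r d d<n fr@(_ , e , above) = bit⇒∈ r (FirstReturn⇒up r (suc d) fr) , return⇒c′-pos≡0 r d d<n e , minimal
      where
      minimal : ∀ j → c′ z (pos r) j ≡ + 0 → ∣ cinterval (pos r) (pos (d N.+ r)) ∣ N.≤ ∣ cinterval (pos r) j ∣
      minimal j e′ = subst₂ N._≤_ (sym (∣cinterval-pos∣ r d d<n)) (sym (∣cinterval∣ (pos r) j)) (s≤s (NP.≮⇒≥ ≮))
        where
        ≮ : ¬ (offset (pos r) j N.< d)
        ≮ d′<d = ZP.<-irrefl (sym (c′-pos≡0⇒return r j e′)) (above _ (s≤s (NP.m≤n+m r _)) (NP.+-monoˡ-< r (s≤s d′<d)))

    ∉⇒ends-IsPr′ : ∀ (b : Fin n) → b ∉ z → 0ℤ Z.≤ drift → Σ (Fin n) λ j → IsPr′ z j b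
    ∉⇒ends-IsPr′ b b∉z drift≥0 = from-return (WalkOf.NonNegativeDrift.down⇒ends-first-return z drift≥0 e (NP.m≤n+m n (toℕ b)) down)
      where
      e : ℕ
      e = toℕ b N.+ n
      down : bits z e ≡ false
      down = trans (bits-periodic z (toℕ b)) (∉⇒¬bit-toℕ b b∉z)
      from-return : (Σ ℕ λ t → t N.≤ e × e N.< n N.+ t × FirstReturn t (suc e N.∸ t)) → Σ (Fin n) λ j → IsPr′ z j b
      from-return (t , t≤e , e<n+t , fr) = pos t , subst (IsPr′ z (pos t)) pos≡b (FirstReturn⇒IsPr′ t d d<n (subst (FirstReturn t) L≡ fr))
        where
        d : ℕ
        d = e N.∸ t
        L≡ : suc e N.∸ t ≡ suc d
        L≡ = NP.+-∸-assoc 1 t≤e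
        d<n : d N.< n
        d<n = NP.m<n+o⇒m∸n<o e t (subst (e N.<_) (NP.+-comm n t) e<n+t)
        pos≡b : pos (d N.+ t) ≡ b
        pos≡b = trans (cong pos (NP.m∸n+n≡m t≤e)) (pos-+n-toℕ b)

    ∉⇒CycMatch₀ : ∀ (i : Fin n) → i ∉ z → 0ℤ Z.≤ drift → CycMatch₀ z i
    ∉⇒CycMatch₀ i i∉z drift≥0 = let (j , _ , c′≡0 , _) = ∉⇒ends-IsPr′ i i∉z drift≥0 in j , c′≡0

    csg-s*⇒above : ∀ r → pos r ∈ z → csg z (pos r) ≡ s* → ∀ s → r N.< s → s N.≤ n N.+ r → W r Z.< W s
    csg-s*⇒above r rz cs = up-never-returns⇒above r (n N.+ r) (∈⇒bit r rz)
      (λ t r<t t≤ e → ¬match (return⇒CycMatch₁ r t r<t t≤ e))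
      where
      ¬match : ¬ CycMatch₁ z (pos r)
      ¬match = [ proj₂ , (λ p → ⊥-elim (proj₁ p rz)) ]′ (csg-s*⇒ z (pos r) cs)

    above⇒csg-s* : ∀ r → bits z r ≡ true → (∀ s → r N.< s → s N.≤ n N.+ r → W r Z.< W s) → csg z (pos r) ≡ s*
    above⇒csg-s* r br above = csg∈≡s* z (pos r) (bit⇒∈ r br) ¬match
      where
      ¬match : ¬ CycMatch₁ z (pos r)
      ¬match m = returns-above (CycMatch₁⇒return r m)
        where
        returns-above : (Σ ℕ λ t → r N.< t × t N.≤ n N.+ r × W t ≡ W r) → ⊥
        returns-above (t , r<t , t≤ , e) = ZP.<-irrefl (sym e) (above t r<t t≤)

  -- The set p(x)

  ones : Subset n → Subset n
  ones x = tabulate (λ i → is-s1 (csg x i))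

  ∈ones⇒csg≡s1 : ∀ (z : Subset n) k → k ∈ ones z → csg z k ≡ s1
  ∈ones⇒csg≡s1 z k h = is-s1⇒≡s1 (csg z k) (trans (sym (VP.lookup∘tabulate (λ i → is-s1 (csg z i)) k)) (VP.[]=⇒lookup h))

  csg≡s1⇒∈ones : ∀ (z : Subset n) k → csg z k ≡ s1 → k ∈ ones z
  csg≡s1⇒∈ones z k e = VP.lookup⇒[]= k (ones z) (trans (VP.lookup∘tabulate (λ i → is-s1 (csg z i)) k) (cong is-s1 e))

  ones⊆ : ∀ (z : Subset n) → ones z ⊆ z
  ones⊆ z {k} h = proj₁ (csg-s1⇒ z k (∈ones⇒csg≡s1 z k h))

  W-n+n≡∣z∣+∣z∣ : ∀ (z : Subset n) → WalkOf.W z n Z.+ + n ≡ + ∣ z ∣ Z.+ + ∣ z ∣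
  W-n+n≡∣z∣+∣z∣ z = trans (step-count (bits z) n)
    (cong (λ u → u Z.+ u) (sym (trans (∣∣-∑Fin z) (∑Fin-∑< _ _ (λ k → cong 𝟙 (sym (bits-toℕ z k)))))))
    where
    step-count : ∀ (g : ℕ → Bool) N → ∑< (λ t → step (g t)) N Z.+ + N ≡ ∑< (λ t → 𝟙 (g t)) N Z.+ ∑< (λ t → 𝟙 (g t)) N
    step-count g zero = refl
    step-count g (suc N) = begin
        ∑< (λ t → step (g t)) N Z.+ step (g N) Z.+ + suc N
      ≡⟨ cong (λ u → ∑< (λ t → step (g t)) N Z.+ step (g N) Z.+ u) (ZP.pos-+ 1 N) ⟩
        ∑< (λ t → step (g t)) N Z.+ step (g N) Z.+ (1ℤ Z.+ + N)
      ≡⟨ e (∑< (λ t → step (g t)) N) (step (g N)) (+ N) ⟩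
        ∑< (λ t → step (g t)) N Z.+ + N Z.+ (step (g N) Z.+ 1ℤ)
      ≡⟨ cong₂ Z._+_ (step-count g N) (bit (g N)) ⟩
        ∑< (λ t → 𝟙 (g t)) N Z.+ ∑< (λ t → 𝟙 (g t)) N Z.+ (𝟙 (g N) Z.+ 𝟙 (g N))
      ≡⟨ e′ (∑< (λ t → 𝟙 (g t)) N) (𝟙 (g N)) ⟩
        ∑< (λ t → 𝟙 (g t)) N Z.+ 𝟙 (g N) Z.+ (∑< (λ t → 𝟙 (g t)) N Z.+ 𝟙 (g N)) ∎
      where
      open ≡-Reasoning
      e : ∀ a s x → a Z.+ s Z.+ (1ℤ Z.+ x) ≡ a Z.+ x Z.+ (s Z.+ 1ℤ)
      e = solve-∀
      e′ : ∀ a i → a Z.+ a Z.+ (i Z.+ i) ≡ a Z.+ i Z.+ (a Z.+ i)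
      e′ = solve-∀
      bit : ∀ c → step c Z.+ 1ℤ ≡ 𝟙 c Z.+ 𝟙 c
      bit true = refl
      bit false = refl

  InQ⇒drift≥0 : ∀ (z : Subset n) → InQ z → 0ℤ Z.≤ WalkOf.drift z
  InQ⇒drift≥0 z q = ≤-by-diff {+ n} {+ (2 N.* ∣ z ∣)} (Z.+≤+ q) (e (WalkOf.W z n) (+ n) (+ ∣ z ∣) (W-n+n≡∣z∣+∣z∣ z))
    where
    e : ∀ w a c → w Z.+ a ≡ c Z.+ c → 0ℤ Z.- w ≡ a Z.- (c Z.+ (c Z.+ 0ℤ))
    e w a c h = trans (e₁ w a) (trans (cong (λ u → a Z.- u) h) (cong (λ u → a Z.- (c Z.+ u)) (sym (ZP.+-identityʳ c))))
      where
      e₁ : ∀ w a → 0ℤ Z.- w ≡ a Z.- (w Z.+ a)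
      e₁ = solve-∀

  -- The walk of `ones x` is the walk of x with every star step turned into a down step; relative to
  -- the future minimum `low` of the walk of x this subtracts twice the rise of `low`.
  module Ones (x : Subset n) (drift≥0 : 0ℤ Z.≤ WalkOf.drift x) where
    open WalkOf x using (W; W-up; W-suc≢W; up⇒W<W-suc; down⇒W-suc<W; ivt↓; ivt↑; ≤∧<-suc⇒≡; up-never-returns⇒above; drift)
    open WalkOf.NonNegativeDrift x drift≥0

    P : Subset n
    P = ones x

    Wp : ℕ → ℤ
    Wp = WalkOf.W P

    isStar : ℕ → Bool
    isStar r = does (Star? r)

    up∧¬Star⇒CycMatch₁ : ∀ r → bits x r ≡ true → ¬ Star r → CycMatch₁ x (pos r)
    up∧¬Star⇒CycMatch₁ r up ¬star with low-attained (suc r)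
    ... | s , r<s , s≤ , e with s NP.≤? n N.+ r
    ... | no s≰ = ⊥-elim (ZP.<-irrefl refl (ZP.<-≤-trans (up⇒W<W-suc r up) (ZP.≤-trans W-suc≤Ws Ws≤Wr)))
      where
      Ws≤Wr : W s Z.≤ W r
      Ws≤Wr = subst (Z._≤ W r) e (ZP.≮⇒≥ ¬star)
      s≡ : s ≡ suc r N.+ n
      s≡ = NP.≤-antisym (subst (s N.≤_) (trans (NP.+-suc n r) (cong suc (NP.+-comm n r))) s≤)
                        (subst (N._≤ s) (cong suc (NP.+-comm n r)) (NP.≰⇒> s≰))
      W-suc≤Ws : W (suc r) Z.≤ W s
      W-suc≤Ws = subst (λ u → W (suc r) Z.≤ W u) (sym s≡) (W≤W+period (suc r))
    ... | yes s≤n+r with ivt↓ (suc r) s (W r) r<s (ZP.<⇒≤ (up⇒W<W-suc r up)) (subst (Z._≤ W r) e (ZP.≮⇒≥ ¬star))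
    ... | t , r<t , t≤s , Wt≡Wr = return⇒CycMatch₁ x r t r<t (NP.≤-trans t≤s s≤n+r) Wt≡Wr

    bits-ones : ∀ r → bits P r ≡ (bits x r ∧ not (isStar r))
    bits-ones r = trans (VP.lookup∘tabulate (λ i → is-s1 (csg x i)) (pos r)) (cases (bits x r) refl)
      where
      cases : ∀ b → bits x r ≡ b → is-s1 (csg x (pos r)) ≡ (b ∧ not (isStar r))
      cases false e = cong is-s1 (csg≡s0 x (pos r) (¬bit⇒∉ x r e) (∉⇒CycMatch₀ x (pos r) (¬bit⇒∉ x r e) drift≥0))
      cases true e with Star? r
      ... | yes star = cong is-s1 (above⇒csg-s* x r e (λ s r<s _ → Star⇒below r star s r<s))
      ... | no ¬star = cong is-s1 (csg≡s1 x (pos r) (bit⇒∈ x r e) (up∧¬Star⇒CycMatch₁ r e ¬star))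

    δ : ℕ → ℤ
    δ t = low t Z.- low 0

    Wp≡W-2δ : ∀ t → Wp t ≡ W t Z.- δ t Z.- δ t
    Wp≡W-2δ zero = e (low 0)
      where
      e : ∀ a → 0ℤ ≡ 0ℤ Z.- (a Z.- a) Z.- (a Z.- a)
      e = solve-∀
    Wp≡W-2δ (suc t) = trans (cong (λ u → Wp t Z.+ step u) (bits-ones t)) (cases (Star? t))
      where
      open ≡-Reasoning
      cases : (d : Dec (Star t)) → Wp t Z.+ step (bits x t ∧ not (does d)) ≡ W (suc t) Z.- δ (suc t) Z.- δ (suc t)
      cases (yes star) with Star-step t star
      ... | low≡W , low-suc≡ , up = begin
          Wp t Z.+ step (bits x t ∧ false)
        ≡⟨ cong₂ Z._+_ (Wp≡W-2δ t) (cong (λ u → step (u ∧ false)) up) ⟩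
          W t Z.- δ t Z.- δ t Z.+ -1ℤ
        ≡⟨ cong (λ u → W t Z.- (u Z.- low 0) Z.- (u Z.- low 0) Z.+ -1ℤ) low≡W ⟩
          W t Z.- (W t Z.- low 0) Z.- (W t Z.- low 0) Z.+ -1ℤ
        ≡⟨ e (W t) (low 0) ⟩
          W t Z.+ 1ℤ Z.- (W t Z.+ 1ℤ Z.- low 0) Z.- (W t Z.+ 1ℤ Z.- low 0)
        ≡⟨ cong₂ (λ u v → u Z.- (v Z.- low 0) Z.- (v Z.- low 0)) (sym (W-up t up)) (sym low-suc≡) ⟩
          W (suc t) Z.- δ (suc t) Z.- δ (suc t) ∎
        where
        e : ∀ w f → w Z.- (w Z.- f) Z.- (w Z.- f) Z.+ -1ℤ ≡ w Z.+ 1ℤ Z.- (w Z.+ 1ℤ Z.- f) Z.- (w Z.+ 1ℤ Z.- f)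
        e = solve-∀
      cases (no ¬star) = begin
          Wp t Z.+ step (bits x t ∧ true)
        ≡⟨ cong₂ Z._+_ (Wp≡W-2δ t) (cong step (∧-true (bits x t))) ⟩
          W t Z.- δ t Z.- δ t Z.+ step (bits x t)
        ≡⟨ cong (λ u → W t Z.- (u Z.- low 0) Z.- (u Z.- low 0) Z.+ step (bits x t)) (sym (¬Star⇒low-suc≡low t ¬star)) ⟩
          W t Z.- δ (suc t) Z.- δ (suc t) Z.+ step (bits x t)
        ≡⟨ e (W t) (δ (suc t)) (step (bits x t)) ⟩
          W (suc t) Z.- δ (suc t) Z.- δ (suc t) ∎
        where
        ∧-true : ∀ b → b ∧ true ≡ b
        ∧-true true = refl
        ∧-true false = refl
        e : ∀ w d s → w Z.- d Z.- d Z.+ s ≡ w Z.+ s Z.- d Z.- d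
        e = solve-∀

    ∣x∣+∣P∣≡n : ∣ x ∣ N.+ ∣ P ∣ ≡ n
    ∣x∣+∣P∣≡n = double-injective (∣ x ∣ N.+ ∣ P ∣) n (ZP.+-injective (begin
        + (∣ x ∣ N.+ ∣ P ∣ N.+ (∣ x ∣ N.+ ∣ P ∣))
      ≡⟨ e₀ (+ ∣ x ∣) (+ ∣ P ∣) ⟩
        (+ ∣ x ∣ Z.+ + ∣ x ∣) Z.+ (+ ∣ P ∣ Z.+ + ∣ P ∣)
      ≡⟨ cong₂ Z._+_ (sym (W-n+n≡∣z∣+∣z∣ x)) (sym (W-n+n≡∣z∣+∣z∣ P)) ⟩
        W n Z.+ + n Z.+ (Wp n Z.+ + n)
      ≡⟨ cong (λ u → W n Z.+ + n Z.+ (u Z.+ + n)) (trans (Wp≡W-2δ n) (cong (λ u → W n Z.- u Z.- u) δ-period)) ⟩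
        drift Z.+ + n Z.+ (drift Z.- drift Z.- drift Z.+ + n)
      ≡⟨ e₁ drift (+ n) ⟩
        + (n N.+ n) ∎))
      where
      open ≡-Reasoning
      δ-period : δ n ≡ drift
      δ-period = trans (cong (Z._- low 0) (trans (low-period 0) (ZP.+-comm (low 0) drift))) (e drift (low 0))
        where
        e : ∀ d f → d Z.+ f Z.- f ≡ d
        e = solve-∀
      e₀ : ∀ a c → a Z.+ c Z.+ (a Z.+ c) ≡ (a Z.+ a) Z.+ (c Z.+ c)
      e₀ = solve-∀
      e₁ : ∀ d m → d Z.+ m Z.+ (d Z.- d Z.- d Z.+ m) ≡ m Z.+ m
      e₁ = solve-∀

    private
      Wp≡⇒2δ≡ : ∀ s t → Wp s ≡ Wp t → W s Z.- W t ≡ (low s Z.+ low s) Z.- (low t Z.+ low t)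
      Wp≡⇒2δ≡ s t e = begin
          W s Z.- W t
        ≡⟨ E (W s) (W t) (low s) (low t) (low 0) ⟩
          (low s Z.+ low s) Z.- (low t Z.+ low t) Z.+ ((W s Z.- δ s Z.- δ s) Z.- (W t Z.- δ t Z.- δ t))
        ≡⟨ cong (λ u → (low s Z.+ low s) Z.- (low t Z.+ low t) Z.+ u) (ZP.i≡j⇒i-j≡0 (trans (sym (Wp≡W-2δ s)) (trans e (Wp≡W-2δ t)))) ⟩
          (low s Z.+ low s) Z.- (low t Z.+ low t) Z.+ 0ℤ
        ≡⟨ ZP.+-identityʳ _ ⟩
          (low s Z.+ low s) Z.- (low t Z.+ low t) ∎
        where
        open ≡-Reasoning
        E : ∀ a c f g h → a Z.- c ≡ (f Z.+ f) Z.- (g Z.+ g) Z.+ ((a Z.- (f Z.- h) Z.- (f Z.- h)) Z.- (c Z.- (g Z.- h) Z.- (g Z.- h)))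
        E = solve-∀

      Wp≡∧low≤⇒W≤ : ∀ s t → Wp s ≡ Wp t → low s Z.≤ low t → W s Z.≤ W t
      Wp≡∧low≤⇒W≤ s t e le = ≤-by-diff (ZP.+-mono-≤ le le) (Wp≡⇒2δ≡ s t e)

      W≡∧low≤⇒Wp≤ : ∀ s t → W s ≡ W t → low t Z.≤ low s → Wp s Z.≤ Wp t
      W≡∧low≤⇒Wp≤ s t e le = subst₂ Z._≤_ (sym (Wp≡W-2δ s)) (sym (Wp≡W-2δ t)) (≤-by-diff (ZP.+-mono-≤ le le) (begin
          (W s Z.- δ s Z.- δ s) Z.- (W t Z.- δ t Z.- δ t)
        ≡⟨ E (W s) (W t) (low s) (low t) (low 0) ⟩
          (low t Z.+ low t) Z.- (low s Z.+ low s) Z.+ (W s Z.- W t)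
        ≡⟨ cong (λ u → (low t Z.+ low t) Z.- (low s Z.+ low s) Z.+ u) (ZP.i≡j⇒i-j≡0 e) ⟩
          (low t Z.+ low t) Z.- (low s Z.+ low s) Z.+ 0ℤ
        ≡⟨ ZP.+-identityʳ _ ⟩
          (low t Z.+ low t) Z.- (low s Z.+ low s) ∎))
        where
        open ≡-Reasoning
        E : ∀ a c f g h → a Z.- (f Z.- h) Z.- (f Z.- h) Z.- (c Z.- (g Z.- h) Z.- (g Z.- h)) ≡ (g Z.+ g) Z.- (f Z.+ f) Z.+ (a Z.- c)
        E = solve-∀

      Wp≡∧low≡⇒W≡ : ∀ s t → Wp s ≡ Wp t → low s ≡ low t → W s ≡ W t
      Wp≡∧low≡⇒W≡ s t e le = ZP.i-j≡0⇒i≡j _ _ (trans (Wp≡⇒2δ≡ s t e) (trans (cong (λ u → (u Z.+ u) Z.- (low t Z.+ low t)) le) (ZP.+-inverseʳ (low t Z.+ low t))))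

    module _ (i : Fin n) where
      private
        r : ℕ
        r = toℕ i

      LinMatch₀-ones⇒LinMatch₀ : bits x r ≡ false → LinMatch₀ P i → LinMatch₀ x i
      LinMatch₀-ones⇒LinMatch₀ down m = from-visitᴾ (LinMatch₀⇒visit P i m)
        where
        from-visit : ∀ {t₀} → (Σ ℕ λ t → t₀ N.≤ t × t N.≤ r × W t ≡ W (suc r)) → LinMatch₀ x i
        from-visit (t , _ , t≤r , e) =
          [ (λ t<r → visit⇒LinMatch₀ x i t t<r e) , (λ t≡r → ⊥-elim (W-suc≢W r (sym (trans (cong W (sym t≡r)) e)))) ]′ (NP.m≤n⇒m<n∨m≡n t≤r)
        from-visitᴾ : (Σ ℕ λ t → t N.< r × Wp t ≡ Wp (suc r)) → LinMatch₀ x i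
        from-visitᴾ (t , t<r , e) = from-visit (ivt↑ t r (W (suc r)) (NP.<⇒≤ t<r)
                                      (Wp≡∧low≤⇒W≤ t (suc r) e (low-mono t (suc r) (NP.≤-trans (NP.<⇒≤ t<r) (NP.n≤1+n r))))
                                      (ZP.<⇒≤ (down⇒W-suc<W r down)))

      -- The last visit t′ of the level W (r + 1) before r has the same future minimum as r + 1.
      LinMatch₀⇒LinMatch₀-ones : bits x r ≡ false → LinMatch₀ x i → LinMatch₀ P i
      LinMatch₀⇒LinMatch₀-ones down m = from-visit (LinMatch₀⇒visit x i m)
        where
        from-last : ∀ {t} → BoundedSearch.Greatest (λ s → W s ZP.≤? W (suc r)) t r → LinMatch₀ P i
        from-last (t′ , _ , t′≤r , Wt′≤ , last) = visit⇒LinMatch₀ P i t′ t′<r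
            (trans (Wp≡W-2δ t′) (trans (cong₂ (λ u v → u Z.- v Z.- v) Wt′≡ (cong (Z._- low 0) low≡)) (sym (Wp≡W-2δ (suc r)))))
          where
          t′<r : t′ N.< r
          t′<r = [ (λ lt → lt) , (λ t′≡r → ⊥-elim (ZP.<-irrefl refl (ZP.<-≤-trans (down⇒W-suc<W r down) (subst (λ u → W u Z.≤ W (suc r)) t′≡r Wt′≤)))) ]′ (NP.m≤n⇒m<n∨m≡n t′≤r)
          above : ∀ s → t′ N.< s → s N.≤ r → W (suc r) Z.< W s
          above s a b = ZP.≰⇒> (last s a b)
          Wt′≡ : W t′ ≡ W (suc r)
          Wt′≡ = ≤∧<-suc⇒≡ t′ (W (suc r)) Wt′≤ (above (suc t′) NP.≤-refl t′<r)
          low-suc≤W : ∀ q → t′ N.≤ q → low (suc r) Z.≤ W q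
          low-suc≤W q t′≤q with q NP.≤? r
          ... | no q≰r = low≤W q (suc r) (NP.≰⇒> q≰r)
          ... | yes q≤r = [ (λ t′<q → ZP.≤-trans (low≤W-self (suc r)) (ZP.<⇒≤ (above q t′<q q≤r))) ,
                            (λ t′≡q → subst (λ u → low (suc r) Z.≤ W u) t′≡q (subst (low (suc r) Z.≤_) (sym Wt′≡) (low≤W-self (suc r)))) ]′
                          (NP.m≤n⇒m<n∨m≡n t′≤q)
          low≡ : low t′ ≡ low (suc r)
          low≡ = ZP.≤-antisym (low-mono t′ (suc r) (NP.≤-trans t′≤r (NP.n≤1+n r)))
                              (let (q , t′≤q , _ , e₀) = low-attained t′ in subst (low (suc r) Z.≤_) (sym e₀) (low-suc≤W q t′≤q))
        from-visit : (Σ ℕ λ t → t N.< toℕ i × W t ≡ W (suc r)) → LinMatch₀ P i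
        from-visit (t , t<r , e) = from-last (BoundedSearch.greatest (λ s → W s ZP.≤? W (suc r)) t r (NP.<⇒≤ t<r) (ZP.≤-reflexive e))

      Star⇒¬LinMatch₁ : Star r → ¬ LinMatch₁ x i
      Star⇒¬LinMatch₁ star m = returns-above (LinMatch₁⇒return x i m)
        where
        returns-above : (Σ ℕ λ t → suc (suc r) N.≤ t × t N.≤ n × W t ≡ W r) → ⊥
        returns-above (t , r+2≤t , _ , e) = ZP.<-irrefl (sym e) (Star⇒below r star t (NP.≤-trans (NP.n≤1+n (suc r)) r+2≤t))

      -- At a star r the future minimum jumps from W r to W r + 1, which forces W t < low t for any earlier
      -- visit t of the level of r + 1 in the walk of P.
      Star⇒¬LinMatch₀-ones : Star r → ¬ LinMatch₀ P i
      Star⇒¬LinMatch₀-ones star m = contradiction (LinMatch₀⇒visit P i m) (Star-step r star)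
        where
        contradiction : (Σ ℕ λ t → t N.< r × Wp t ≡ Wp (suc r)) → (low r ≡ W r) × (low (suc r) ≡ W r Z.+ 1ℤ) × (bits x r ≡ true) → ⊥
        contradiction (t , t<r , e) (_ , low-suc≡ , up) = ZP.<-irrefl refl (ZP.≤-<-trans (low≤W-self t) (+1≤⇒< W+1≤low))
          where
          diff : W t Z.- (W r Z.+ 1ℤ) ≡ (low t Z.+ low t) Z.- ((W r Z.+ 1ℤ) Z.+ (W r Z.+ 1ℤ))
          diff = subst₂ (λ u v → W t Z.- u ≡ (low t Z.+ low t) Z.- (v Z.+ v)) (W-up r up) low-suc≡ (Wp≡⇒2δ≡ t (suc r) e)
          W+1≤low : W t Z.+ 1ℤ Z.≤ low t
          W+1≤low = ≤-by-diff (low≤W r t (NP.<⇒≤ t<r)) (ZP.i-j≡0⇒i≡j _ _ (trans (E (W t) (W r) (low t)) (ZP.i≡j⇒i-j≡0 diff)))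
            where
            E : ∀ a w l → (a Z.+ 1ℤ Z.- l) Z.- (l Z.- w) ≡ (a Z.- (w Z.+ 1ℤ)) Z.- ((l Z.+ l) Z.- ((w Z.+ 1ℤ) Z.+ (w Z.+ 1ℤ)))
            E = solve-∀

      LinMatch₁⇒LinMatch₁-ones : bits x r ≡ true → ¬ Star r → LinMatch₁ x i → LinMatch₁ P i
      LinMatch₁⇒LinMatch₁-ones up ¬star m = from-return (LinMatch₁⇒return x i m)
        where
        upP : bits P r ≡ true
        upP = trans (bits-ones r) (cong₂ _∧_ up (cong not (dec-false (Star? r) ¬star)))
        from-visit : ∀ t → t N.≤ n → (Σ ℕ λ t′ → suc r N.≤ t′ × t′ N.≤ t × Wp t′ ≡ Wp r) → LinMatch₁ P i
        from-visit t t≤n (t′ , r<t′ , t′≤t , e′) =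
          [ (λ r+1<t′ → return⇒LinMatch₁ P i t′ r+1<t′ (NP.≤-trans t′≤t t≤n) e′) ,
            (λ r+1≡t′ → ⊥-elim (WalkOf.W-suc≢W P r (trans (cong Wp r+1≡t′) e′))) ]′ (NP.m≤n⇒m<n∨m≡n r<t′)
        from-return : (Σ ℕ λ t → suc (suc r) N.≤ t × t N.≤ n × W t ≡ W r) → LinMatch₁ P i
        from-return (t , r+2≤t , t≤n , e) = from-visit t t≤n
          (WalkOf.ivt↓ P (suc r) t (Wp r) (NP.≤-trans (NP.n≤1+n (suc r)) r+2≤t) (ZP.<⇒≤ (WalkOf.up⇒W<W-suc P r upP))
            (W≡∧low≤⇒Wp≤ t r e (low-mono r t (NP.≤-trans (NP.n≤1+n r) (NP.≤-trans (NP.n≤1+n (suc r)) r+2≤t)))))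

      LinMatch₁-ones⇒LinMatch₁ : bits x r ≡ true → ¬ Star r → LinMatch₁ P i → LinMatch₁ x i
      LinMatch₁-ones⇒LinMatch₁ up ¬star m = cases (linMatch₁? x i) (LinMatch₁⇒return P i m)
        where
        cases : Dec (LinMatch₁ x i) → (Σ ℕ λ t → suc (suc r) N.≤ t × t N.≤ n × Wp t ≡ Wp r) → LinMatch₁ x i
        cases (yes m′) _ = m′
        cases (no ¬m) (t , r+2≤t , t≤n , e) = ⊥-elim (ZP.<-irrefl (sym (Wp≡∧low≡⇒W≡ t r e low-t≡low-r)) (above t r<t t≤n))
          where
          r<t : r N.< t
          r<t = NP.≤-trans (NP.n≤1+n (suc r)) r+2≤t
          above : ∀ s → r N.< s → s N.≤ n → W r Z.< W s
          above = up-never-returns⇒above r n up λ s r<s s≤n eq →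
            [ (λ r+1<s → ¬m (return⇒LinMatch₁ x i s r+1<s s≤n eq)) , (λ r+1≡s → W-suc≢W r (trans (cong W r+1≡s) eq)) ]′ (NP.m≤n⇒m<n∨m≡n r<s)
          -- low (r + 1) is attained beyond n, since the walk stays above W r on (r, n].
          low-t≡low-r : low t ≡ low r
          low-t≡low-r with low-attained (suc r)
          ... | q , r<q , _ , e₀ with q NP.≤? n
          ...   | yes q≤n = ⊥-elim (ZP.<-irrefl refl (ZP.<-≤-trans (above q r<q q≤n) (subst (Z._≤ W r) e₀ (ZP.≮⇒≥ ¬star))))
          ...   | no q≰n = trans (ZP.≤-antisym (subst (low t Z.≤_) (sym e₀) (low≤W q t (NP.≤-trans t≤n (NP.<⇒≤ (NP.≰⇒> q≰n)))))
                                                (low-mono (suc r) t r<t))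
                                 (¬Star⇒low-suc≡low r ¬star)
    sg-ones≡sg : ∀ i → sg P i ≡ sg x i
    sg-ones≡sg i = cases (bits x r) refl
      where
      r : ℕ
      r = toℕ i
      bitP : ∀ b → bits x r ≡ b → bits P r ≡ (b ∧ not (isStar r))
      bitP b e = trans (bits-ones r) (cong (λ u → u ∧ not (isStar r)) e)
      cases : ∀ b → bits x r ≡ b → sg P i ≡ sg x i
      cases false down = sg-∉-cong P x (¬bit-toℕ⇒∉ P i (bitP false down)) (¬bit-toℕ⇒∉ x i down)
                           (LinMatch₀-ones⇒LinMatch₀ i down) (LinMatch₀⇒LinMatch₀-ones i down)
      cases true up = star-cases (Star? r)
        where
        star-cases : Dec (Star r) → sg P i ≡ sg x i
        star-cases (yes star) = trans (sg∉≡s* P i (¬bit-toℕ⇒∉ P i (trans (bitP true up) (cong not (dec-true (Star? r) star))))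
                                             (Star⇒¬LinMatch₀-ones i star))
                                      (sym (sg∈≡s* x i (bit-toℕ⇒∈ x i up) (Star⇒¬LinMatch₁ i star)))
        star-cases (no ¬star) = sg-∈-cong P x (bit-toℕ⇒∈ P i (trans (bitP true up) (cong not (dec-false (Star? r) ¬star)))) (bit-toℕ⇒∈ x i up)
                                  (LinMatch₁-ones⇒LinMatch₁ i up ¬star) (LinMatch₁⇒LinMatch₁-ones i up ¬star)

    IsP-ones : IsP x P
    IsP-ones = sg-ones≡sg , ∣x∣+∣P∣≡n

  -- Uniqueness of p(x) and the covering relation

  module _ (z : Subset n) where
    open WalkOf z using (W; up-never-returns⇒above; down-never-visited⇒above; W-suc≢W)

    ∈∧sg-s*⇒above : ∀ (i : Fin n) → i ∈ z → sg z i ≡ s* → ∀ s → toℕ i N.< s → s N.≤ n → W (toℕ i) Z.< W s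
    ∈∧sg-s*⇒above i iz si = up-never-returns⇒above (toℕ i) n (∈⇒bit-toℕ z i iz) λ t i<t t≤n eq →
      [ (λ i+1<t → ¬match (return⇒LinMatch₁ z i t i+1<t t≤n eq)) , (λ i+1≡t → W-suc≢W (toℕ i) (trans (cong W i+1≡t) eq)) ]′ (NP.m≤n⇒m<n∨m≡n i<t)
      where
      ¬match : ¬ LinMatch₁ z i
      ¬match = [ proj₂ , (λ p → ⊥-elim (proj₁ p iz)) ]′ (sg-s*⇒ z i si)

    ∉∧sg-s*⇒below : ∀ (j : Fin n) → j ∉ z → sg z j ≡ s* → ∀ s → s N.≤ toℕ j → W (suc (toℕ j)) Z.< W s
    ∉∧sg-s*⇒below j jz sj = down-never-visited⇒above (toℕ j) (∉⇒¬bit-toℕ z j jz) (λ t t<j eq → ¬match (visit⇒LinMatch₀ z j t t<j eq))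
      where
      ¬match : ¬ LinMatch₀ z j
      ¬match = [ (λ p → ⊥-elim (jz (proj₁ p))) , proj₂ ]′ (sg-s*⇒ z j sj)

    ¬s*-∈-before-∉ : ∀ (i j : Fin n) → toℕ i N.< toℕ j → i ∈ z → j ∉ z → sg z i ≡ s* → sg z j ≡ s* → ⊥
    ¬s*-∈-before-∉ i j i<j iz jz si sj = ZP.<-asym (∈∧sg-s*⇒above i iz si (suc (toℕ j)) (NP.m<n⇒m<1+n i<j) (FP.toℕ<n j))
                                                     (∉∧sg-s*⇒below j jz sj (toℕ i) (NP.<⇒≤ i<j))

  sg-equal∧∈∧∉⇒∣∣< : ∀ (z z′ : Subset n) → (∀ i → sg z i ≡ sg z′ i) → ∀ i → i ∈ z → i ∉ z′ → ∣ z′ ∣ N.< ∣ z ∣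
  sg-equal∧∈∧∉⇒∣∣< z z′ same i iz iz′ = p⊂q⇒∣p∣<∣q∣ (z′⊆z , i , iz , iz′)
    where
    si′ : sg z′ i ≡ s*
    si′ = [ (λ e → ⊥-elim (sg-s0⇒∉ z i (trans (same i) e) iz)) , (λ e → e) ]′ (sg-∉ z′ i iz′)
    si : sg z i ≡ s*
    si = trans (same i) si′
    z′⊆z : z′ ⊆ z
    z′⊆z {k} kz′ = [ (λ e → sg-s1⇒∈ z k (trans (same k) e)) , unmatched ]′ (sg-∈ z′ k kz′)
      where
      unmatched : sg z′ k ≡ s* → k ∈ z
      unmatched sk′ with NP.<-cmp (toℕ k) (toℕ i)
      ... | tri< k<i _ _ = ⊥-elim (¬s*-∈-before-∉ z′ k i k<i kz′ iz′ sk′ si′)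
      ... | tri≈ _ k≡i _ = ⊥-elim (iz′ (subst (_∈ z′) (FP.toℕ-injective k≡i) kz′))
      ... | tri> _ _ i<k with k ∈? z
      ...   | yes kz = kz
      ...   | no kz = ⊥-elim (¬s*-∈-before-∉ z i k i<k iz kz si (trans (same k) sk′))

  sg-equal∧∣∣≡⇒≡ : ∀ (z z′ : Subset n) → (∀ i → sg z i ≡ sg z′ i) → ∣ z ∣ ≡ ∣ z′ ∣ → z ≡ z′
  sg-equal∧∣∣≡⇒≡ z z′ same size = ⊆-antisym z⊆z′ z′⊆z
    where
    z⊆z′ : z ⊆ z′
    z⊆z′ {i} iz with i ∈? z′
    ... | yes iz′ = iz′
    ... | no iz′ = ⊥-elim (NP.<-irrefl (sym size) (sg-equal∧∈∧∉⇒∣∣< z z′ same i iz iz′))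
    z′⊆z : z′ ⊆ z
    z′⊆z {i} iz′ with i ∈? z
    ... | yes iz = iz
    ... | no iz = ⊥-elim (NP.<-irrefl size (sg-equal∧∈∧∉⇒∣∣< z′ z (λ k → sym (same k)) i iz′ iz))

  IsP-unique : ∀ (x p q : Subset n) → IsP x p → IsP x q → p ≡ q
  IsP-unique x p q (sp , ∣p∣) (sq , ∣q∣) = sg-equal∧∣∣≡⇒≡ p q (λ i → trans (sp i) (sym (sq i))) (NP.+-cancelˡ-≡ ∣ x ∣ _ _ (trans ∣p∣ (sym ∣q∣)))

  module _ (z : Subset n) (i : Fin n) where
    open WalkOf z using (W)

    csg-s*⇒above-toℕ : i ∈ z → csg z i ≡ s* → ∀ s → toℕ i N.< s → s N.≤ n N.+ toℕ i → W (toℕ i) Z.< W s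
    csg-s*⇒above-toℕ iz cs = csg-s*⇒above z (toℕ i) (subst (_∈ z) (sym (pos-toℕ i)) iz) (subst (λ u → csg z u ≡ s*) (sym (pos-toℕ i)) cs)

    above⇒csg-s*-toℕ : i ∈ z → (∀ s → toℕ i N.< s → s N.≤ n N.+ toℕ i → W (toℕ i) Z.< W s) → csg z i ≡ s*
    above⇒csg-s*-toℕ iz above = subst (λ u → csg z u ≡ s*) (pos-toℕ i) (above⇒csg-s* z (toℕ i) (∈⇒bit-toℕ z i iz) above)

  W-diff-mono : ∀ (y x : Subset n) → y ⊆ x → ∀ k r → WalkOf.W y (k N.+ r) Z.- WalkOf.W y r Z.≤ WalkOf.W x (k N.+ r) Z.- WalkOf.W x r
  W-diff-mono y x y⊆x zero r = ZP.≤-reflexive (trans (ZP.+-inverseʳ (WalkOf.W y r)) (sym (ZP.+-inverseʳ (WalkOf.W x r))))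
  W-diff-mono y x y⊆x (suc k) r = ≤-by-diff₂ (W-diff-mono y x y⊆x k r) (step-mono (bits y (k N.+ r)) (bits x (k N.+ r)) (λ h → ∈⇒bit x (k N.+ r) (y⊆x (bit⇒∈ y (k N.+ r) h))))
    (E (WalkOf.W y (k N.+ r)) (WalkOf.W y r) (step (bits y (k N.+ r))) (WalkOf.W x (k N.+ r)) (WalkOf.W x r) (step (bits x (k N.+ r))))
    where
    step-mono : ∀ a b → (a ≡ true → b ≡ true) → step a Z.≤ step b
    step-mono true b h rewrite h refl = ZP.≤-refl
    step-mono false true _ = Z.-≤+
    step-mono false false _ = ZP.≤-refl
    E : ∀ a b c d e f → a Z.+ c Z.- b Z.- (d Z.+ f Z.- e) ≡ (a Z.- b Z.+ c) Z.- (d Z.- e Z.+ f)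
    E = solve-∀

  -- The walk of a larger set only gets steeper.
  csg-s*-mono : ∀ (y x : Subset n) → y ⊆ x → ∀ i → i ∈ y → csg y i ≡ s* → csg x i ≡ s*
  csg-s*-mono y x y⊆x i iy cs = above⇒csg-s*-toℕ x i (y⊆x iy) λ s r<s s≤ →
    <-by-diff (csg-s*⇒above-toℕ y i iy cs s r<s s≤)
      (subst (λ u → WalkOf.W y u Z.- WalkOf.W y (toℕ i) Z.≤ WalkOf.W x u Z.- WalkOf.W x (toℕ i)) (NP.m∸n+n≡m (NP.<⇒≤ r<s))
        (W-diff-mono y x y⊆x (s N.∸ toℕ i) (toℕ i)))

  csg-s*⇒∈ : ∀ (x : Subset n) → 0ℤ Z.≤ WalkOf.drift x → ∀ a → csg x a ≡ s* → a ∈ x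
  csg-s*⇒∈ x drift≥0 a e = [ proj₁ , (λ p → ⊥-elim (proj₂ p (∉⇒CycMatch₀ x a (proj₁ p) drift≥0))) ]′ (csg-s*⇒ x a e)

  InQ⇒IsP-ones : ∀ (z : Subset n) → InQ z → IsP z (ones z)
  InQ⇒IsP-ones z q = Ones.IsP-ones z (InQ⇒drift≥0 z q)

  ≺⇒⊆∧removed-s* : ∀ (x y : Subset n) → y ≺ x → (y ⊆ x) × (∀ a → a ∈ x → a ∉ y → csg x a ≡ s*)
  ≺⇒⊆∧removed-s* x y (qx , _ , _ , px , _ , IsP-px , _ , px⊆py , py⊆y , y⊆x) = y⊆x , removed
    where
    removed : ∀ a → a ∈ x → a ∉ y → csg x a ≡ s*
    removed a ax ay = [ (λ e → ⊥-elim (ay (py⊆y (px⊆py (subst (a ∈_) (sym px≡) (csg≡s1⇒∈ones x a e)))))) , (λ e → e) ]′ (csg-∈ x a ax)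
      where
      px≡ : px ≡ ones x
      px≡ = IsP-unique x px (ones x) IsP-px (InQ⇒IsP-ones x qx)

  remove-s*⇒≺ : ∀ (x y : Subset n) a → InQ x → InQ y → a ∈ x → y ≡ x - a → csg x a ≡ s* → y ≺ x
  remove-s*⇒≺ x y a qx qy ax y≡ ca = qx , qy , y≢x , ones x , ones y , InQ⇒IsP-ones x qx , InQ⇒IsP-ones y qy , ones-mono , ones⊆ y , y⊆x
    where
    y⊆x : y ⊆ x
    y⊆x {k} h = proj₁ (∈-⁻ x a (subst (k ∈_) y≡ h))
    y≢x : y ≢ x
    y≢x e = a∉p-a x a (subst (a ∈_) (trans (sym e) y≡) ax)
    ones-mono : ones x ⊆ ones y
    ones-mono {k} h = csg≡s1⇒∈ones y k ([ (λ e → e) , (λ e → ⊥-elim (s1≢s* (trans (sym cx) (csg-s*-mono y x y⊆x k ky e)))) ]′ (csg-∈ y k ky))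
      where
      s1≢s* : s1 ≢ s*
      s1≢s* ()
      cx : csg x k ≡ s1
      cx = ∈ones⇒csg≡s1 x k h
      ky : k ∈ y
      ky = subst (k ∈_) (sym y≡) (x∈p∧x≢y⇒x∈p-y (proj₁ (csg-s1⇒ x k cx)) (λ k≡a → s1≢s* (trans (sym cx) (trans (cong (csg x) k≡a) ca))))

  ≺⇔remove-s* : ∀ (x y : Subset n) → InQ x → InQ y → suc ∣ y ∣ ≡ ∣ x ∣ → (y ≺ x) ⇔ (∃ λ a → csg x a ≡ s* × y ≡ x - a)
  ≺⇔remove-s* x y qx qy size = mk⇔ to from
    where
    to : y ≺ x → ∃ λ a → csg x a ≡ s* × y ≡ x - a
    to y≺x@(_ , _ , y≢x , _) = outside (FP.any? (λ a → (a ∈? x) ×-dec ¬? (a ∈? y)))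
      where
      y⊆x : y ⊆ x
      y⊆x = proj₁ (≺⇒⊆∧removed-s* x y y≺x)
      outside : Dec (∃ λ a → a ∈ x × a ∉ y) → ∃ λ a → csg x a ≡ s* × y ≡ x - a
      outside (yes (a , ax , ay)) = a , proj₂ (≺⇒⊆∧removed-s* x y y≺x) a ax ay ,
        ⊆∧∣∣≤⇒≡ (λ {k} ky → x∈p∧x≢y⇒x∈p-y (y⊆x ky) (λ { refl → ay ky }))
                 (NP.≤-reflexive (NP.suc-injective (trans (sym (∣p∣≡1+∣p-a∣ x a ax)) (sym size))))
      outside (no none) = ⊥-elim (y≢x (⊆-antisym y⊆x x⊆y))
        where
        x⊆y : x ⊆ y
        x⊆y {a} ax with a ∈? y
        ... | yes ay = ay
        ... | no ay = ⊥-elim (none (a , ax , ay))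
    from : (∃ λ a → csg x a ≡ s* × y ≡ x - a) → y ≺ x
    from (a , ca , y≡) = remove-s*⇒≺ x y a qx qy (csg-s*⇒∈ x (InQ⇒drift≥0 x qx) a ca) y≡ ca

  -- Maximal intervals of I′(y)

  offset-pos′ : ∀ r (i : Fin n) d → pos r ≡ i → d N.< n → offset i (pos (d N.+ r)) ≡ d
  offset-pos′ r i d refl d<n = offset-pos r d d<n

  pos-offset′ : ∀ r (i k : Fin n) → pos r ≡ i → pos (offset i k N.+ r) ≡ k
  pos-offset′ r i k refl = pos-offset r k

  pos-injective-within-period : ∀ r t → r N.≤ t → t N.< n N.+ r → pos t ≡ pos r → t ≡ r
  pos-injective-within-period r t r≤t t< e = trans (sym (NP.m∸n+n≡m r≤t)) (cong (N._+ r) d≡0)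
    where
    d : ℕ
    d = t N.∸ r
    d≡0 : d ≡ 0
    d≡0 = trans (sym (offset-pos r d (NP.m<n+o⇒m∸n<o t r (subst (t N.<_) (NP.+-comm n r) t<))))
                (trans (cong (offset (pos r)) (trans (cong pos (NP.m∸n+n≡m r≤t)) e)) (offset-self (pos r)))

  pos≡⇒≡+periods : ∀ r (b : Fin n) → pos r ≡ b → r ≡ toℕ b N.+ (r / n) N.* n
  pos≡⇒≡+periods r b e = trans (m≡m%n+[m/n]*n r n) (cong (N._+ (r / n) N.* n) (trans (sym (toℕ-pos r)) (cong toℕ e)))

  -- the representative of the start j in the period ending at toℕ b + n
  start-before : Fin n → Fin n → ℕ
  start-before j b = toℕ b N.+ n N.∸ offset j b

  pos-start-before : ∀ (j b : Fin n) → pos (start-before j b) ≡ j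
  pos-start-before j b = FP.toℕ-injective (trans (toℕ-pos (start-before j b)) (cases (toℕ j NP.≤? toℕ b)))
    where
    cases : Dec (toℕ j N.≤ toℕ b) → (toℕ b N.+ n N.∸ offsetℕ (toℕ j) (toℕ b)) % n ≡ toℕ j
    cases (yes j≤b) rewrite offsetℕ-≤ j≤b = trans (cong (_% n) e) (trans ([m+n]%n≡m%n (toℕ j) n) (m<n⇒m%n≡m (FP.toℕ<n j)))
      where
      e : toℕ b N.+ n N.∸ (toℕ b N.∸ toℕ j) ≡ toℕ j N.+ n
      e = trans (NP.+-∸-comm n (NP.m∸n≤m (toℕ b) (toℕ j))) (cong (N._+ n) (NP.m∸[m∸n]≡n j≤b))
    cases (no j≰b) rewrite offsetℕ-> {toℕ j} {toℕ b} (NP.≰⇒> j≰b) =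
      trans (cong (_% n) (NP.m∸[m∸n]≡n (NP.≤-trans (NP.<⇒≤ (FP.toℕ<n j)) (NP.m≤n+m n (toℕ b))))) (m<n⇒m%n≡m (FP.toℕ<n j))

  start-before+offset : ∀ (j b : Fin n) → offset j b N.+ start-before j b ≡ toℕ b N.+ n
  start-before+offset j b = NP.m+[n∸m]≡n (NP.≤-trans (NP.<⇒≤ (offset<n j b)) (NP.m≤n+m n (toℕ b)))

  module _ (y : Subset n) where
    open WalkOf y using (W; FirstReturn)

    IsPr′⇒FirstReturn-at : ∀ r (j b : Fin n) → pos r ≡ j → IsPr′ y j b → FirstReturn r (suc (offset j b))
    IsPr′⇒FirstReturn-at r j b refl ip = IsPr′⇒FirstReturn y r b ip

    IsPr′⇒csg≡s1 : ∀ {j b} → IsPr′ y j b → csg y j ≡ s1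
    IsPr′⇒csg≡s1 {j} {b} (jy , c′≡0 , _) = csg≡s1 y j jy (b , c′≡0)

    -- Two first returns sharing an end point: the longer one would pass through the start of the shorter.
    IsPr′-start-unique : ∀ (j₁ j₂ b : Fin n) → IsPr′ y j₁ b → IsPr′ y j₂ b → j₁ ≡ j₂
    IsPr′-start-unique j₁ j₂ b ip₁ ip₂ = trans (sym (pos-start-before j₁ b))
      (trans (cong (λ u → pos (toℕ b N.+ n N.∸ u)) same-offset) (pos-start-before j₂ b))
      where
      first-return : ∀ j → IsPr′ y j b → FirstReturn (start-before j b) (suc (offset j b))
      first-return j ip = IsPr′⇒FirstReturn-at (start-before j b) j b (pos-start-before j b) ip
      ¬shorter : ∀ j j′ → offset j b N.< offset j′ b → IsPr′ y j b → IsPr′ y j′ b → ⊥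
      ¬shorter j j′ lt ip ip′ = ZP.<-irrefl (trans W-start′≡ (sym W-start≡)) (above (start-before j b) start′<start start<end′)
        where
        FR : FirstReturn (start-before j b) (suc (offset j b))
        FR = first-return j ip
        FR′ : FirstReturn (start-before j′ b) (suc (offset j′ b))
        FR′ = first-return j′ ip′
        above : ∀ s → start-before j′ b N.< s → s N.< suc (offset j′ b) N.+ start-before j′ b → W (start-before j′ b) Z.< W s
        above = proj₂ (proj₂ FR′)
        W-start≡ : W (start-before j b) ≡ W (suc (toℕ b N.+ n))
        W-start≡ = trans (sym (proj₁ (proj₂ FR))) (cong (λ u → W (suc u)) (start-before+offset j b))
        W-start′≡ : W (start-before j′ b) ≡ W (suc (toℕ b N.+ n))
        W-start′≡ = trans (sym (proj₁ (proj₂ FR′))) (cong (λ u → W (suc u)) (start-before+offset j′ b))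
        start′<start : start-before j′ b N.< start-before j b
        start′<start = NP.∸-monoʳ-< lt (NP.≤-trans (NP.<⇒≤ (offset<n j′ b)) (NP.m≤n+m n (toℕ b)))
        start<end′ : start-before j b N.< suc (offset j′ b) N.+ start-before j′ b
        start<end′ = subst (start-before j b N.<_) (sym (cong suc (start-before+offset j′ b))) (s≤s (NP.m∸n≤m (toℕ b N.+ n) (offset j b)))
      same-offset : offset j₁ b ≡ offset j₂ b
      same-offset with NP.<-cmp (offset j₁ b) (offset j₂ b)
      ... | tri< lt _ _ = ⊥-elim (¬shorter j₁ j₂ lt ip₁ ip₂)
      ... | tri≈ _ eq _ = eq
      ... | tri> _ _ gt = ⊥-elim (¬shorter j₂ j₁ gt ip₂ ip₁)

    IsPr′-end-unique : ∀ (j b b′ : Fin n) → IsPr′ y j b → IsPr′ y j b′ → b ≡ b′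
    IsPr′-end-unique j b b′ ip ip′ = trans (sym (pos-offset′ (toℕ j) j b (pos-toℕ j)))
      (trans (cong (λ u → pos (u N.+ toℕ j)) same-offset) (pos-offset′ (toℕ j) j b′ (pos-toℕ j)))
      where
      r : ℕ
      r = toℕ j
      ¬shorter : ∀ e e′ → offset j e N.< offset j e′ → IsPr′ y j e → IsPr′ y j e′ → ⊥
      ¬shorter e e′ lt ip ip′ = ZP.<-irrefl (sym (proj₁ (proj₂ FR))) (proj₂ (proj₂ FR′) (suc (offset j e) N.+ r) (s≤s (NP.m≤n+m r _)) (NP.+-monoˡ-< r (s≤s lt)))
        where
        FR : FirstReturn r (suc (offset j e))
        FR = IsPr′⇒FirstReturn-at r j e (pos-toℕ j) ip
        FR′ : FirstReturn r (suc (offset j e′))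
        FR′ = IsPr′⇒FirstReturn-at r j e′ (pos-toℕ j) ip′
      same-offset : offset j b ≡ offset j b′
      same-offset with NP.<-cmp (offset j b) (offset j b′)
      ... | tri< lt _ _ = ⊥-elim (¬shorter b b′ lt ip ip′)
      ... | tri≈ _ eq _ = eq
      ... | tri> _ _ gt = ⊥-elim (¬shorter b′ b gt ip′ ip)

    StaysAbove : ℕ → Set
    StaysAbove r = ∀ s → r N.< s → s N.≤ n N.+ r → W (suc r) Z.≤ W s

    -- Adding such a b to y gives a set covering y (csg-s*⇔Addable).
    Addable : Fin n → Set
    Addable b = (b ∉ y) × StaysAbove (toℕ b)

    private
      StaysAbove-+periods : ∀ q r → StaysAbove r → StaysAbove (r N.+ q N.* n)
      StaysAbove-+periods q r above s r<s s≤ = subst (λ u → W (suc r N.+ q N.* n) Z.≤ W u) s′+qn≡s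
        (≤-by-diff (above s′ r<s′ s′≤) (WalkOf.W-diff-periods y q (suc r) s′))
        where
        qn : ℕ
        qn = q N.* n
        s′ : ℕ
        s′ = s N.∸ qn
        s′+qn≡s : s′ N.+ qn ≡ s
        s′+qn≡s = NP.m∸n+n≡m (NP.≤-trans (NP.m≤n+m qn r) (NP.<⇒≤ r<s))
        r<s′ : r N.< s′
        r<s′ = NP.+-cancelʳ-< qn r s′ (subst (r N.+ qn N.<_) (sym s′+qn≡s) r<s)
        s′≤ : s′ N.≤ n N.+ r
        s′≤ = NP.+-cancelʳ-≤ qn s′ (n N.+ r) (subst₂ N._≤_ (sym s′+qn≡s) (sym (NP.+-assoc n r qn)) s≤)

      StaysAbove-−periods : ∀ q r → StaysAbove (r N.+ q N.* n) → StaysAbove r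
      StaysAbove-−periods q r above s r<s s≤ = ≤-by-diff (above (s N.+ q N.* n) (NP.+-monoˡ-< (q N.* n) r<s)
        (subst (s N.+ q N.* n N.≤_) (NP.+-assoc n r (q N.* n)) (NP.+-monoˡ-≤ (q N.* n) s≤))) (sym (WalkOf.W-diff-periods y q (suc r) s))

    Addable⇒StaysAbove-at : ∀ b → Addable b → ∀ r → pos r ≡ b → StaysAbove r
    Addable⇒StaysAbove-at b (_ , above) r e = subst StaysAbove (sym (pos≡⇒≡+periods r b e)) (StaysAbove-+periods (r / n) (toℕ b) above)

    StaysAbove-at⇒StaysAbove : ∀ b r → pos r ≡ b → StaysAbove r → StaysAbove (toℕ b)
    StaysAbove-at⇒StaysAbove b r e above = StaysAbove-−periods (r / n) (toℕ b) (subst StaysAbove (pos≡⇒≡+periods r b e) above)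

    Addable⇒covering-start≡ : ∀ (j b a e : Fin n) → Addable b → IsPr′ y j b → IsPr′ y a e → j ∈ cinterval a e → a ≡ j
    Addable⇒covering-start≡ j b a e addable ipJ ipK j∈K = cases (NP.m≤n⇒m<n∨m≡n (z≤n {d}))
      where
      d : ℕ
      d = offset a j
      d≤ : d N.≤ offset a e
      d≤ = ∈cinterval⇒offset≤ a e j j∈K
      ra : ℕ
      ra = toℕ a N.+ n
      pos-ra : pos ra ≡ a
      pos-ra = pos-+n-toℕ a
      rj : ℕ
      rj = d N.+ ra
      pos-rj : pos rj ≡ j
      pos-rj = pos-offset′ ra a j pos-ra
      cases : (0 N.< d) ⊎ (0 ≡ d) → a ≡ j
      cases (inj₂ d≡0) = trans (sym (pos-toℕ a)) (trans (cong (λ u → pos (u N.+ toℕ a)) d≡0) (pos-offset′ (toℕ a) a j (pos-toℕ a)))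
      cases (inj₁ d>0) = ⊥-elim (ZP.<-irrefl refl (ZP.≤-<-trans (ZP.≤-trans Wrj≤W-endK (ZP.≤-reflexive returnK)) Wra<Wrj))
        where
        L : ℕ
        L = suc (offset a e)
        frK : FirstReturn ra L
        frK = IsPr′⇒FirstReturn-at ra a e pos-ra ipK
        ℓ : ℕ
        ℓ = suc (offset j b)
        frJ : FirstReturn rj ℓ
        frJ = IsPr′⇒FirstReturn-at rj j b pos-rj ipJ
        returnK : W (L N.+ ra) ≡ W ra
        returnK = proj₁ (proj₂ frK)
        Wra<Wrj : W ra Z.< W rj
        Wra<Wrj = proj₂ (proj₂ frK) rj (NP.+-monoˡ-≤ ra d>0) (NP.+-monoˡ-< ra (s≤s d≤))
        above-b : StaysAbove (offset j b N.+ rj)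
        above-b = Addable⇒StaysAbove-at b addable (offset j b N.+ rj) (pos-offset′ rj j b pos-rj)
        Wrj≤W-endK : W rj Z.≤ W (L N.+ ra)
        Wrj≤W-endK with NP.<-cmp (L N.+ ra) (ℓ N.+ rj)
        ... | tri< lt _ _ = ZP.<⇒≤ (proj₂ (proj₂ frJ) (L N.+ ra) (NP.+-monoˡ-< ra (s≤s d≤)) lt)
        ... | tri≈ _ eq _ = ZP.≤-reflexive (sym (trans (cong W eq) (proj₁ (proj₂ frJ))))
        ... | tri> _ _ gt = subst (Z._≤ W (L N.+ ra)) (proj₁ (proj₂ frJ)) (above-b (L N.+ ra) (NP.≤-pred (NP.m<n⇒m<1+n gt)) endK≤)
          where
          endK≤ : L N.+ ra N.≤ n N.+ (offset j b N.+ rj)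
          endK≤ = NP.≤-trans (NP.+-monoˡ-≤ ra (offset<n a e))
                    (NP.≤-trans (NP.+-monoʳ-≤ n (NP.m≤n+m ra d)) (NP.+-monoʳ-≤ n (NP.m≤n+m rj (offset j b))))

    Addable⇒MaxI′ : ∀ (j b : Fin n) → Addable b → IsPr′ y j b → MaxI′ y (cinterval j b)
    Addable⇒MaxI′ j b addable ip = (j , IsPr′⇒csg≡s1 ip , b , ip , refl) , maximal
      where
      maximal : ∀ K → InI′ y K → cinterval j b ⊆ K → K ≡ cinterval j b
      maximal K (a , _ , e , ipK , K≡) J⊆K = trans K≡ (cong₂ cinterval a≡j (IsPr′-end-unique a e b ipK (subst (λ u → IsPr′ y u b) (sym a≡j) ip)))
        where
        a≡j : a ≡ j
        a≡j = Addable⇒covering-start≡ j b a e addable ip ipK (subst (j ∈_) K≡ (J⊆K (start∈cinterval j b)))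

    -- A dip after the end of a maximal interval would produce a first return enclosing it.
    MaxI′⇒Addable : ∀ (j b : Fin n) → MaxI′ y (cinterval j b) → IsPr′ y j b → 0ℤ Z.≤ WalkOf.drift y → Addable b
    MaxI′⇒Addable j b (_ , maximal) ip drift≥0 = b∉y , StaysAbove-at⇒StaysAbove b rb pos-rb stays
      where
      rj : ℕ
      rj = toℕ j N.+ n
      pos-rj : pos rj ≡ j
      pos-rj = pos-+n-toℕ j
      dJ : ℕ
      dJ = offset j b
      frJ : FirstReturn rj (suc dJ)
      frJ = IsPr′⇒FirstReturn-at rj j b pos-rj ip
      rb : ℕ
      rb = dJ N.+ rj
      pos-rb : pos rb ≡ b
      pos-rb = pos-offset′ rj j b pos-rj
      b∉y : b ∉ y
      b∉y = subst (_∉ y) pos-rb (¬bit⇒∉ y rb (WalkOf.FirstReturn⇒last-down y rj (suc dJ) frJ))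
      enclosed : (Σ ℕ λ a → Σ ℕ λ u → a N.< rj × suc rb N.< u × u N.≤ n N.+ a × FirstReturn a (u N.∸ a)) → ⊥
      enclosed (a , u , a<rj , e<u , u≤n+a , frK) = pos-a∉J (subst (pos a ∈_) K≡J (start∈cinterval (pos a) (pos (d′ N.+ a))))
        where
        d′ : ℕ
        d′ = u N.∸ suc a
        rj≤rb : rj N.≤ rb
        rj≤rb = NP.m≤n+m rj dJ
        rb<u : rb N.< u
        rb<u = NP.<-trans (NP.n<1+n rb) e<u
        a<u : a N.< u
        a<u = NP.<-trans a<rj (NP.≤-<-trans rj≤rb rb<u)
        u<n+a+1 : u N.< suc a N.+ n
        u<n+a+1 = s≤s (subst (u N.≤_) (NP.+-comm n a) u≤n+a)
        d′<n : d′ N.< n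
        d′<n = NP.m<n+o⇒m∸n<o u (suc a) u<n+a+1
        ipK : IsPr′ y (pos a) (pos (d′ N.+ a))
        ipK = FirstReturn⇒IsPr′ y a d′ d′<n (subst (FirstReturn a) (NP.+-∸-assoc 1 a<u) frK)
        J⊆K : cinterval j b ⊆ cinterval (pos a) (pos (d′ N.+ a))
        J⊆K {k} k∈J = offset≤⇒∈cinterval (pos a) (pos (d′ N.+ a)) k (subst₂ N._≤_ (sym offset≡) (sym (offset-pos a d′ d′<n)) e≤d′)
          where
          t : ℕ
          t = offset j k N.+ rj
          a<t : a N.< t
          a<t = NP.<-≤-trans a<rj (NP.m≤n+m rj (offset j k))
          t<u : t N.< u
          t<u = NP.≤-<-trans (NP.+-monoˡ-≤ rj (∈cinterval⇒offset≤ j b k k∈J)) rb<u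
          e : ℕ
          e = t N.∸ a
          e+a≡t : e N.+ a ≡ t
          e+a≡t = NP.m∸n+n≡m (NP.<⇒≤ a<t)
          offset≡ : offset (pos a) k ≡ e
          offset≡ = subst (λ v → offset (pos a) v ≡ e) (trans (cong pos e+a≡t) (pos-offset′ rj j k pos-rj))
                      (offset-pos a e (NP.m<n+o⇒m∸n<o t a (NP.<-≤-trans t<u (subst (u N.≤_) (NP.+-comm n a) u≤n+a))))
          e≤d′ : e N.≤ d′
          e≤d′ = NP.∸-monoˡ-≤ (suc a) t<u
        K≡J : cinterval (pos a) (pos (d′ N.+ a)) ≡ cinterval j b
        K≡J = maximal _ (pos a , IsPr′⇒csg≡s1 ipK , pos (d′ N.+ a) , ipK , refl) J⊆K
        pos-a∉J : pos a ∉ cinterval j b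
        pos-a∉J a∈J = NP.<-irrefl (sym t≡a) a<t
          where
          t : ℕ
          t = offset j (pos a) N.+ rj
          a<t : a N.< t
          a<t = NP.<-≤-trans a<rj (NP.m≤n+m rj (offset j (pos a)))
          t≡a : t ≡ a
          t≡a = pos-injective-within-period a t (NP.<⇒≤ a<t)
                  (NP.<-≤-trans (NP.≤-<-trans (NP.+-monoˡ-≤ rj (∈cinterval⇒offset≤ j b (pos a) a∈J)) rb<u) u≤n+a)
                  (pos-offset′ rj j (pos a) pos-rj)
      stays : StaysAbove rb
      stays s rb<s s≤ with W (suc rb) ZP.≤? W s
      ... | yes ≤ = ≤
      ... | no ≰ = ⊥-elim (enclosed (WalkOf.NonNegativeDrift.dip⇒enclosing-first-return y drift≥0 rj (suc dJ) s (NP.m≤n+m n (toℕ j)) frJ e<s dip))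
        where
        dip : W s Z.< W rj
        dip = subst (W s Z.<_) (proj₁ (proj₂ frJ)) (ZP.≰⇒> ≰)
        e<s : suc dJ N.+ rj N.< s
        e<s = NP.≤∧≢⇒< rb<s (λ e≡s → ZP.<-irrefl (trans (cong W (sym e≡s)) (proj₁ (proj₂ frJ))) dip)

  bits-minus : ∀ (x : Subset n) b t → pos t ≢ b → bits (x - b) t ≡ bits x t
  bits-minus x b t t≢b = trans (lookup-─ x ⁅ b ⁆ (pos t)) (trans (cong (λ u → lookup x (pos t) ∧ not u) ∉⁅b⁆) (∧-true (lookup x (pos t))))
    where
    ∉⁅b⁆ : lookup ⁅ b ⁆ (pos t) ≡ false
    ∉⁅b⁆ = ∉⇒¬bit ⁅ b ⁆ t (λ h → t≢b (x∈⁅y⁆⇒x≡y b h))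
    ∧-true : ∀ c → c ∧ true ≡ c
    ∧-true true = refl
    ∧-true false = refl

  W-diff-agree : ∀ (z z′ : Subset n) p k → (∀ t → p N.≤ t → t N.< k N.+ p → bits z t ≡ bits z′ t) →
                 WalkOf.W z (k N.+ p) Z.- WalkOf.W z p ≡ WalkOf.W z′ (k N.+ p) Z.- WalkOf.W z′ p
  W-diff-agree z z′ p zero h = trans (ZP.+-inverseʳ (WalkOf.W z p)) (sym (ZP.+-inverseʳ (WalkOf.W z′ p)))
  W-diff-agree z z′ p (suc k) h = begin
      WalkOf.W z (k N.+ p) Z.+ step (bits z (k N.+ p)) Z.- WalkOf.W z p
    ≡⟨ E (WalkOf.W z (k N.+ p)) (WalkOf.W z p) (step (bits z (k N.+ p))) ⟩
      (WalkOf.W z (k N.+ p) Z.- WalkOf.W z p) Z.+ step (bits z (k N.+ p))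
    ≡⟨ cong₂ Z._+_ (W-diff-agree z z′ p k (λ t p≤t t< → h t p≤t (NP.m<n⇒m<1+n t<))) (cong step (h (k N.+ p) (NP.m≤n+m p k) NP.≤-refl)) ⟩
      (WalkOf.W z′ (k N.+ p) Z.- WalkOf.W z′ p) Z.+ step (bits z′ (k N.+ p))
    ≡⟨ sym (E (WalkOf.W z′ (k N.+ p)) (WalkOf.W z′ p) (step (bits z′ (k N.+ p)))) ⟩
      WalkOf.W z′ (k N.+ p) Z.+ step (bits z′ (k N.+ p)) Z.- WalkOf.W z′ p ∎
    where
    open ≡-Reasoning
    E : ∀ a b c → a Z.+ c Z.- b ≡ (a Z.- b) Z.+ c
    E = solve-∀

  W-diff-after-removed : ∀ (x : Subset n) b → ∀ s → toℕ b N.< s → s N.≤ n N.+ toℕ b →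
    WalkOf.W (x - b) s Z.- WalkOf.W (x - b) (suc (toℕ b)) ≡ WalkOf.W x s Z.- WalkOf.W x (suc (toℕ b))
  W-diff-after-removed x b s b<s s≤ =
    subst (λ u → WalkOf.W (x - b) u Z.- WalkOf.W (x - b) (suc (toℕ b)) ≡ WalkOf.W x u Z.- WalkOf.W x (suc (toℕ b))) (NP.m∸n+n≡m b<s)
      (W-diff-agree (x - b) x (suc (toℕ b)) (s N.∸ suc (toℕ b)) (λ t b<t t< → bits-minus x b t (λ pos≡b → NP.<⇒≢ b<t (sym (t≡b t b<t t< pos≡b)))))
    where
    t≡b : ∀ t → toℕ b N.< t → t N.< s N.∸ suc (toℕ b) N.+ suc (toℕ b) → pos t ≡ b → t ≡ toℕ b
    t≡b t b<t t< pos≡b = pos-injective-within-period (toℕ b) t (NP.<⇒≤ b<t)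
      (NP.<-≤-trans (subst (t N.<_) (NP.m∸n+n≡m b<s) t<) s≤) (trans pos≡b (sym (pos-toℕ b)))

  csg-s*⇔Addable : ∀ (x : Subset n) b → b ∈ x → (csg x b ≡ s*) ⇔ Addable (x - b) b
  csg-s*⇔Addable x b b∈x = mk⇔ to from
    where
    r : ℕ
    r = toℕ b
    up : WalkOf.W x (suc r) ≡ WalkOf.W x r Z.+ 1ℤ
    up = WalkOf.W-up x r (∈⇒bit-toℕ x b b∈x)
    to : csg x b ≡ s* → Addable (x - b) b
    to cs = a∉p-a x b , λ s r<s s≤ → ZP.0≤i-j⇒j≤i (subst (0ℤ Z.≤_) (sym (W-diff-after-removed x b s r<s s≤))
      (ZP.i≤j⇒0≤j-i (subst (Z._≤ WalkOf.W x s) (sym up) (<⇒+1≤ (csg-s*⇒above-toℕ x b b∈x cs s r<s s≤)))))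
    from : Addable (x - b) b → csg x b ≡ s*
    from (_ , stays) = above⇒csg-s*-toℕ x b b∈x λ s r<s s≤ → +1≤⇒< (subst (Z._≤ WalkOf.W x s) up
      (ZP.0≤i-j⇒j≤i (subst (0ℤ Z.≤_) (W-diff-after-removed x b s r<s s≤) (ZP.i≤j⇒0≤j-i (stays s r<s s≤)))))

  -- Between two cyclically consecutive stars j and b of x, the walk rises by exactly one, so after
  -- removing b the interval [j, b] is a first return ending at an addable point.
  consecutive-s*⇒MaxI′ : ∀ (x : Subset n) → 0ℤ Z.≤ WalkOf.drift x → ∀ (j b : Fin n) → j ≢ b → csg x j ≡ s* → csg x b ≡ s* →
                         (∀ k → csg x k ≡ s* → 0 N.< offset j k → offset j k N.< offset j b → ⊥) → MaxI′ (x - b) (cinterval j b)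
  consecutive-s*⇒MaxI′ x drift≥0 j b j≢b csj csb no-s*-between =
    Addable⇒MaxI′ y j b (Equivalence.to (csg-s*⇔Addable x b b∈x) csb) (subst₂ (IsPr′ y) (pos-toℕ j) pos-rb (FirstReturn⇒IsPr′ y rj d d<n fr))
    where
    y : Subset n
    y = x - b
    open WalkOf x using (W; W-up)
    j∈x : j ∈ x
    j∈x = csg-s*⇒∈ x drift≥0 j csj
    b∈x : b ∈ x
    b∈x = csg-s*⇒∈ x drift≥0 b csb
    rj : ℕ
    rj = toℕ j
    d : ℕ
    d = offset j b
    d<n : d N.< n
    d<n = offset<n j b
    rb : ℕ
    rb = d N.+ rj
    pos-rb : pos rb ≡ b
    pos-rb = pos-offset′ rj j b (pos-toℕ j)
    0<d : 0 N.< d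
    0<d = [ (λ lt → lt) , (λ 0≡d → ⊥-elim (j≢b (trans (sym (pos-toℕ j)) (trans (cong (λ u → pos (u N.+ rj)) 0≡d) pos-rb)))) ]′ (NP.m≤n⇒m<n∨m≡n (z≤n {d}))
    rj<rb : rj N.< rb
    rj<rb = NP.+-monoˡ-< rj 0<d
    rb≤n+rj : rb N.≤ n N.+ rj
    rb≤n+rj = NP.+-monoˡ-≤ rj (NP.<⇒≤ d<n)
    above-j : ∀ s → rj N.< s → s N.≤ n N.+ rj → W rj Z.< W s
    above-j = csg-s*⇒above-toℕ x j j∈x csj
    above-b : ∀ s → rb N.< s → s N.≤ n N.+ rb → W rb Z.< W s
    above-b = csg-s*⇒above x rb (subst (_∈ x) (sym pos-rb) b∈x) (subst (λ u → csg x u ≡ s*) (sym pos-rb) csb)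
    W-rj+1 : W (suc rj) ≡ W rj Z.+ 1ℤ
    W-rj+1 = W-up rj (∈⇒bit-toℕ x j j∈x)
    v : ℤ
    v = W rj Z.+ 1ℤ
    -- The last visit of level W rj + 1 before b would be a star strictly between j and b.
    W-rb≡ : W rb ≡ v
    W-rb≡ = ZP.≤-antisym W-rb≤v (<⇒+1≤ (above-j rb rj<rb rb≤n+rj))
      where
      W-rb≤v : W rb Z.≤ v
      W-rb≤v with W rb ZP.≤? v
      ... | yes ≤ = ≤
      ... | no ≰ = ⊥-elim (from-last (BoundedSearch.greatest (λ s → W s ZP.≤? v) (suc rj) rb rj<rb (ZP.≤-reflexive W-rj+1)))
        where
        from-last : BoundedSearch.Greatest (λ s → W s ZP.≤? v) (suc rj) rb → ⊥
        from-last (t , rj<t , t≤rb , Wt≤v , last) = no-s*-between (pos t) cs-t (subst (0 N.<_) (sym offset≡) (NP.m<n⇒0<n∸m rj<t))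
                                                                         (subst (N._< d) (sym offset≡) e<d)
          where
          t<rb : t N.< rb
          t<rb = [ (λ lt → lt) , (λ t≡rb → ⊥-elim (≰ (subst (λ u → W u Z.≤ v) t≡rb Wt≤v))) ]′ (NP.m≤n⇒m<n∨m≡n t≤rb)
          Wt≡v : W t ≡ v
          Wt≡v = ZP.≤-antisym Wt≤v (<⇒+1≤ (above-j t rj<t (NP.≤-trans t≤rb rb≤n+rj)))
          above-t : ∀ s → t N.< s → s N.≤ n N.+ t → W t Z.< W s
          above-t s t<s s≤ with s NP.≤? rb
          ... | yes s≤rb = subst (Z._< W s) (sym Wt≡v) (ZP.≰⇒> (last s t<s s≤rb))
          ... | no s≰rb = ZP.<-trans (subst (Z._< W rb) (sym Wt≡v) (ZP.≰⇒> ≰)) (above-b s (NP.≰⇒> s≰rb) (NP.≤-trans s≤ (NP.+-monoʳ-≤ n (NP.<⇒≤ t<rb))))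
          cs-t : csg x (pos t) ≡ s*
          cs-t = above⇒csg-s* x t (WalkOf.W<W-suc⇒up x t (above-t (suc t) NP.≤-refl (s≤s (NP.m≤n+m t m)))) above-t
          e : ℕ
          e = t N.∸ rj
          e+rj≡t : e N.+ rj ≡ t
          e+rj≡t = NP.m∸n+n≡m (NP.<⇒≤ rj<t)
          e<d : e N.< d
          e<d = NP.+-cancelʳ-< rj e d (subst (N._< rb) (sym e+rj≡t) t<rb)
          offset≡ : offset j (pos t) ≡ e
          offset≡ = subst (λ u → offset j (pos u) ≡ e) e+rj≡t (offset-pos′ rj j e (pos-toℕ j) (NP.<-trans e<d d<n))
    agree : ∀ k → k N.≤ d → WalkOf.W y (k N.+ rj) Z.- WalkOf.W y rj ≡ W (k N.+ rj) Z.- W rj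
    agree k k≤d = W-diff-agree y x rj k λ t rj≤t t< → bits-minus x b t λ pos≡b →
      NP.<-irrefl (sym (pos-injective-within-period t rb (NP.<⇒≤ (t<rb t t<)) (NP.<-≤-trans (NP.+-monoˡ-< rj d<n) (NP.+-monoʳ-≤ n rj≤t))
                     (trans pos-rb (sym pos≡b)))) (t<rb t t<)
      where
      t<rb : ∀ t → t N.< k N.+ rj → t N.< rb
      t<rb t t< = NP.<-≤-trans t< (NP.+-monoˡ-≤ rj k≤d)
    down : bits y rb ≡ false
    down = ∉⇒¬bit y rb (subst (_∉ y) (sym pos-rb) (a∉p-a x b))
    fr : WalkOf.FirstReturn y rj (suc d)
    fr = s≤s z≤n , returns , inside
      where
      returns : WalkOf.W y (suc rb) ≡ WalkOf.W y rj
      returns = level (WalkOf.W-down y rb down) (agree d NP.≤-refl) W-rb≡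
        where
        level : ∀ {p q r a c : ℤ} → p Z.+ 1ℤ ≡ q → q Z.- r ≡ a Z.- c → a ≡ c Z.+ 1ℤ → p ≡ r
        level {p} {r = r} {c = c} refl e refl = trans (E p r) (trans (cong (λ u → u Z.+ r Z.- 1ℤ) e) (E′ c r))
          where
          E : ∀ p r → p ≡ (p Z.+ 1ℤ Z.- r) Z.+ r Z.- 1ℤ
          E = solve-∀
          E′ : ∀ c r → (c Z.+ 1ℤ Z.- c) Z.+ r Z.- 1ℤ ≡ r
          E′ = solve-∀
      inside : ∀ s → rj N.< s → s N.< suc d N.+ rj → WalkOf.W y rj Z.< WalkOf.W y s
      inside s rj<s s< = <-by-diff (above-j s rj<s (NP.≤-trans (NP.≤-pred s<) rb≤n+rj))
        (ZP.≤-reflexive (sym (subst (λ u → WalkOf.W y u Z.- WalkOf.W y rj ≡ W u Z.- W rj) (NP.m∸n+n≡m (NP.<⇒≤ rj<s))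
          (agree (s N.∸ rj) (NP.+-cancelʳ-≤ rj (s N.∸ rj) d (subst (N._≤ rb) (sym (NP.m∸n+n≡m (NP.<⇒≤ rj<s))) (NP.≤-pred s<)))))))

  no-value-cyclically-between : ∀ {K} (f : Fin K → Fin n) → (∀ u v → u F.< v → f u F.< f v) → 2 N.≤ K →
    ∀ (u v : Fin K) → 0 N.< offset (f (predMod u)) (f v) → offset (f (predMod u)) (f v) N.< offset (f (predMod u)) (f u) → ⊥
  no-value-cyclically-between {suc K′} f mono 2≤K (F.suc u′) v 0<off off< with toℕ (f (inject₁ u′)) NP.≤? toℕ (f v)
  ... | yes p≤v = NP.<-irrefl refl (NP.<-≤-trans (subst (N._< toℕ v) (FP.toℕ-inject₁ u′) (monotone⇒reflects-< f mono (inject₁ u′) v p<v))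
                                                  (NP.≤-pred (monotone⇒reflects-< f mono v (F.suc u′) v<u)))
    where
    p<u : toℕ (f (inject₁ u′)) N.< toℕ (f (F.suc u′))
    p<u = mono (inject₁ u′) (F.suc u′) (subst (N._< suc (toℕ u′)) (sym (FP.toℕ-inject₁ u′)) NP.≤-refl)
    p<v : toℕ (f (inject₁ u′)) N.< toℕ (f v)
    p<v = 0<∸⇒< (subst (0 N.<_) (offsetℕ-≤ p≤v) 0<off)
    v<u : toℕ (f v) N.< toℕ (f (F.suc u′))
    v<u = ∸-cancelʳ-< p≤v (NP.<⇒≤ p<u) (subst₂ N._<_ (offsetℕ-≤ p≤v) (offsetℕ-≤ (NP.<⇒≤ p<u)) off<)
  ... | no p≰v = NP.<⇒≱ (NP.<-trans (NP.≤-<-trans (NP.m≤n+m n (toℕ (f v))) v+n<u) (FP.toℕ<n (f (F.suc u′)))) NP.≤-refl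
    where
    p<u : toℕ (f (inject₁ u′)) N.< toℕ (f (F.suc u′))
    p<u = mono (inject₁ u′) (F.suc u′) (subst (N._< suc (toℕ u′)) (sym (FP.toℕ-inject₁ u′)) NP.≤-refl)
    v+n<u : toℕ (f v) N.+ n N.< toℕ (f (F.suc u′))
    v+n<u = ∸-cancelʳ-< (NP.≤-trans (NP.<⇒≤ (FP.toℕ<n (f (inject₁ u′)))) (NP.m≤n+m n _)) (NP.<⇒≤ p<u)
              (subst₂ N._<_ (offsetℕ-> (NP.≰⇒> p≰v)) (offsetℕ-≤ (NP.<⇒≤ p<u)) off<)
  no-value-cyclically-between {suc K′} f mono 2≤K F.zero v 0<off off< with toℕ (f (fromℕ K′)) NP.≤? toℕ (f v)
  ... | yes p≤v = NP.<-irrefl refl (NP.<-≤-trans (subst (N._< toℕ v) (FP.toℕ-fromℕ K′) (monotone⇒reflects-< f mono (fromℕ K′) v p<v))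
                                                  (NP.≤-pred (FP.toℕ<n v)))
    where
    p<v : toℕ (f (fromℕ K′)) N.< toℕ (f v)
    p<v = 0<∸⇒< (subst (0 N.<_) (offsetℕ-≤ p≤v) 0<off)
  ... | no p≰v = NP.<-irrefl refl (NP.<-≤-trans (monotone⇒reflects-< f mono v F.zero v<u) z≤n)
    where
    u<p : toℕ (f F.zero) N.< toℕ (f (fromℕ K′))
    u<p = mono F.zero (fromℕ K′) (subst (0 N.<_) (sym (FP.toℕ-fromℕ K′)) (NP.≤-pred 2≤K))
    p≤+n : ∀ w → toℕ (f (fromℕ K′)) N.≤ w N.+ n
    p≤+n w = NP.≤-trans (NP.<⇒≤ (FP.toℕ<n (f (fromℕ K′)))) (NP.m≤n+m n w)
    v<u : toℕ (f v) N.< toℕ (f F.zero)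
    v<u = NP.+-cancelʳ-< n _ _ (∸-cancelʳ-< (p≤+n _) (p≤+n _) (subst₂ N._<_ (offsetℕ-> (NP.≰⇒> p≰v)) (offsetℕ-> u<p) off<))

  predMod≢ : ∀ {K} (u : Fin K) → 2 N.≤ K → predMod u ≢ u
  predMod≢ {suc K′} F.zero 2≤K e = NP.<-irrefl (sym (trans (sym (FP.toℕ-fromℕ K′)) (cong toℕ e))) (NP.≤-pred 2≤K)
  predMod≢ {suc K′} (F.suc u′) 2≤K e = NP.<-irrefl (cong toℕ e) (subst (N._< suc (toℕ u′)) (sym (FP.toℕ-inject₁ u′)) NP.≤-refl)

  module _ (x : Subset n) (qx : InQ x) where

    ≺⇔remove-enumerated-s* : ∀ {K} (is : Fin K → Fin n) → (∀ a → (csg x a ≡ s*) ⇔ (∃ λ u → is u ≡ a)) →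
      ∀ (y : Subset n) → InQ y → suc ∣ y ∣ ≡ ∣ x ∣ → (y ≺ x) ⇔ (∃ λ u → y ≡ x - is u)
    ≺⇔remove-enumerated-s* is stars y qy size = mk⇔
      (λ y≺x → let (a , cs , y≡) = Equivalence.to (≺⇔remove-s* x y qx qy size) y≺x
                   (u , is-u≡a) = Equivalence.to (stars a) cs
               in u , trans y≡ (cong (x -_) (sym is-u≡a)))
      (λ (u , y≡) → Equivalence.from (≺⇔remove-s* x y qx qy size) (is u , Equivalence.from (stars (is u)) (u , refl) , y≡))

    consecutive-enumerated-s*⇒MaxI′ : ∀ {K} (is : Fin K → Fin n) → (∀ u v → u < v → is u < is v) → 2 N.≤ K →
      (∀ a → (csg x a ≡ s*) ⇔ (∃ λ u → is u ≡ a)) → ∀ u → MaxI′ (x - is u) (cinterval (is (predMod u)) (is u))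
    consecutive-enumerated-s*⇒MaxI′ is mono 2≤K stars u =
      consecutive-s*⇒MaxI′ x (InQ⇒drift≥0 x qx) (is (predMod u)) (is u)
        (λ e → predMod≢ u 2≤K (monotone⇒injective is mono (predMod u) u e))
        (Equivalence.from (stars _) (predMod u , refl)) (Equivalence.from (stars _) (u , refl))
        (λ k cs 0<off off< → let (v , is-v≡k) = Equivalence.to (stars k) cs in
           no-value-cyclically-between is mono 2≤K u v (subst (λ w → 0 N.< offset (is (predMod u)) w) (sym is-v≡k) 0<off)
                                                        (subst (λ w → offset (is (predMod u)) w N.< offset (is (predMod u)) (is u)) (sym is-v≡k) off<))

  module _ (y : Subset n) (qy : InQ y) {s : ℕ} (js prs : Fin s → Fin n)
           (intervals : ∀ r → csg y (js r) ≡ s1 × IsPr′ y (js r) (prs r) × MaxI′ y (cinterval (js r) (prs r)))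
           (all-maximal : ∀ J → MaxI′ y J → ∃ λ r → J ≡ cinterval (js r) (prs r)) where

    private
      ip : ∀ r → IsPr′ y (js r) (prs r)
      ip r = proj₁ (proj₂ (intervals r))
      addable : ∀ r → Addable y (prs r)
      addable r = MaxI′⇒Addable y (js r) (prs r) (proj₂ (proj₂ (intervals r))) (ip r) (InQ⇒drift≥0 y qy)

    add-end-injective : (∀ r r′ → cinterval (js r) (prs r) ≡ cinterval (js r′) (prs r′) → r ≡ r′) →
                        ∀ r r′ → y ∪ ⁅ prs r ⁆ ≡ y ∪ ⁅ prs r′ ⁆ → r ≡ r′
    add-end-injective distinct r r′ e = distinct r r′ (cong₂ cinterval (IsPr′-start-unique y (js r) (js r′) (prs r) (ip r) (subst (IsPr′ y (js r′)) (sym same-end) (ip r′))) same-end)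
      where
      same-end : prs r ≡ prs r′
      same-end = [ (λ h → ⊥-elim (proj₁ (addable r) h)) , x∈⁅y⁆⇒x≡y (prs r′) ]′
                   (x∈p∪q⁻ y ⁅ prs r′ ⁆ (subst (prs r ∈_) e (x∈p∪q⁺ (inj₂ (x∈⁅x⁆ (prs r))))))

    ≺⇔add-end : ∀ (x : Subset n) → InQ x → suc ∣ y ∣ ≡ ∣ x ∣ → (y ≺ x) ⇔ (∃ λ r → x ≡ y ∪ ⁅ prs r ⁆)
    ≺⇔add-end x qx size = mk⇔ to from
      where
      to : y ≺ x → ∃ λ r → x ≡ y ∪ ⁅ prs r ⁆
      to y≺x = r , trans x≡ (cong (λ u → y ∪ ⁅ u ⁆) (sym prs-r≡a))
        where
        removed : ∃ λ a → csg x a ≡ s* × y ≡ x - a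
        removed = Equivalence.to (≺⇔remove-s* x y qx qy size) y≺x
        a : Fin n
        a = proj₁ removed
        y≡ : y ≡ x - a
        y≡ = proj₂ (proj₂ removed)
        x≡ : x ≡ y ∪ ⁅ a ⁆
        x≡ = trans (sym (minus-∪⁅⁆ x a (csg-s*⇒∈ x (InQ⇒drift≥0 x qx) a (proj₁ (proj₂ removed))))) (cong (_∪ ⁅ a ⁆) (sym y≡))
        addable-a : Addable y a
        addable-a = subst (λ z → Addable z a) (sym y≡) (Equivalence.to (csg-s*⇔Addable x a (csg-s*⇒∈ x (InQ⇒drift≥0 x qx) a (proj₁ (proj₂ removed)))) (proj₁ (proj₂ removed)))
        ends : Σ (Fin n) λ j → IsPr′ y j a
        ends = ∉⇒ends-IsPr′ y a (proj₁ addable-a) (InQ⇒drift≥0 y qy)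
        j : Fin n
        j = proj₁ ends
        ipJ : IsPr′ y j a
        ipJ = proj₂ ends
        listed : ∃ λ r → cinterval j a ≡ cinterval (js r) (prs r)
        listed = all-maximal (cinterval j a) (Addable⇒MaxI′ y j a addable-a ipJ)
        r : Fin s
        r = proj₁ listed
        js-r≡j : js r ≡ j
        js-r≡j = Addable⇒covering-start≡ y j a (js r) (prs r) addable-a ipJ (ip r) (subst (j ∈_) (proj₂ listed) (start∈cinterval j a))
        prs-r≡a : prs r ≡ a
        prs-r≡a = IsPr′-end-unique y j (prs r) a (subst (λ u → IsPr′ y u (prs r)) js-r≡j (ip r)) ipJ
      from : (∃ λ r → x ≡ y ∪ ⁅ prs r ⁆) → y ≺ x
      from (r , x≡) = Equivalence.from (≺⇔remove-s* x y qx qy size) (prs r , Equivalence.from (csg-s*⇔Addable x (prs r) b∈x) (subst (λ z → Addable z (prs r)) y≡ (addable r)) , y≡)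
        where
        b∈x : prs r ∈ x
        b∈x = subst (prs r ∈_) (sym x≡) (x∈p∪q⁺ (inj₂ (x∈⁅x⁆ (prs r))))
        y≡ : y ≡ x - prs r
        y≡ = trans (sym (∪⁅⁆-minus y (prs r) (proj₁ (addable r)))) (cong (_- prs r) (sym x≡))

private
  suc[k∸1]≡k : ∀ n k → suc n ≤ℕ 2 * k → suc (k ∸ 1) ≡ k
  suc[k∸1]≡k n (suc k) _ = refl
  suc[k∸1]≡k n zero ()

  n≤2[k∸1] : ∀ n k → n + 2 ≤ℕ 2 * k → n ≤ℕ 2 * (k ∸ 1)
  n≤2[k∸1] n zero h with () ← NP.≤-trans (NP.m≤n+m 2 n) h
  n≤2[k∸1] n (suc k) h = NP.≤-pred (NP.≤-pred (subst₂ _≤ℕ_ (NP.+-comm n 2) (cong suc (NP.+-suc k (k + 0))) h))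

  inhabited∧≢1⇒2≤ : ∀ K → Fin K → K ≢ 1 → 2 ≤ℕ K
  inhabited∧≢1⇒2≤ (suc zero) _ K≢1 = ⊥-elim (K≢1 refl)
  inhabited∧≢1⇒2≤ (suc (suc K)) _ _ = s≤s (s≤s z≤n)

  Subset0-unique : ∀ (p q : Subset 0) → p ≡ q
  Subset0-unique [] [] = refl

proposition2p5-i : ∀ (n k : ℕ) (x : Subset n) → ∣ x ∣ ≡ k → n ≤ℕ 2 * k → k ≤ℕ n → 2 * k ≢ n + 1 →
  (is : Fin (2 * k ∸ n) → Fin n) → (∀ u v → u < v → is u < is v) →
  (∀ a → (csg x a ≡ s*) ⇔ (∃ λ u → is u ≡ a)) →
  (∀ (y : Subset n) → ∣ y ∣ ≡ k ∸ 1 → InQ y → (y ≺ x) ⇔ (∃ λ u → y ≡ x - is u))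
  × (∀ u → MaxI′ (x - is u) (cinterval (is (predMod u)) (is u)))
proposition2p5-i zero .zero x _ _ z≤n _ is _ _ = (λ y _ _ → mk⇔ (λ (_ , _ , y≢x , _) → ⊥-elim (y≢x (Subset0-unique y x))) λ ()) , λ ()
proposition2p5-i (suc m) k x ∣x∣ n≤2k _ 2k≢n+1 is mono stars =
  (λ y ∣y∣ qy → ≺⇔remove-enumerated-s* x qx is stars y qy (trans (cong suc ∣y∣) (trans (suc[k∸1]≡k m k n≤2k) (sym ∣x∣)))) ,
  (λ u → consecutive-enumerated-s*⇒MaxI′ x qx is mono (inhabited∧≢1⇒2≤ _ u K≢1) stars u)
  where
  open Cyclic m
  qx : InQ x
  qx = subst (λ c → suc m ≤ℕ 2 * c) (sym ∣x∣) n≤2k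
  K≢1 : 2 * k ∸ suc m ≢ 1
  K≢1 e = 2k≢n+1 (trans (sym (NP.m∸n+n≡m n≤2k)) (trans (cong (_+ suc m) e) (NP.+-comm 1 (suc m))))

proposition2p5-ii : ∀ (n k : ℕ) (y : Subset n) → n + 2 ≤ℕ 2 * k → k ≤ℕ n → ∣ y ∣ ≡ k ∸ 1 →
  (s : ℕ) (js prs : Fin s → Fin n) →
  (∀ r → csg y (js r) ≡ s1 × IsPr′ y (js r) (prs r) × MaxI′ y (cinterval (js r) (prs r))) →
  (∀ J → MaxI′ y J → ∃ λ r → J ≡ cinterval (js r) (prs r)) →
  (∀ r r′ → cinterval (js r) (prs r) ≡ cinterval (js r′) (prs r′) → r ≡ r′) →
  (∀ r r′ → y ∪ ⁅ prs r ⁆ ≡ y ∪ ⁅ prs r′ ⁆ → r ≡ r′)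
  × (∀ (x : Subset n) → ∣ x ∣ ≡ k → (y ≺ x) ⇔ (∃ λ r → x ≡ y ∪ ⁅ prs r ⁆))
proposition2p5-ii zero zero y () z≤n
proposition2p5-ii (suc m) k y n+2≤2k _ ∣y∣ s js prs intervals all-maximal distinct =
  add-end-injective y qy js prs intervals all-maximal distinct ,
  (λ x ∣x∣ → ≺⇔add-end y qy js prs intervals all-maximal x (qx x ∣x∣) (trans (cong suc ∣y∣) (trans (suc[k∸1]≡k m k n≤2k) (sym ∣x∣))))
  where
  open Cyclic m
  n≤2k : suc m ≤ℕ 2 * k
  n≤2k = NP.≤-trans (NP.m≤m+n (suc m) 2) n+2≤2k
  qy : InQ y
  qy = subst (λ c → suc m ≤ℕ 2 * c) (sym ∣y∣) (n≤2[k∸1] (suc m) k n+2≤2k)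
  qx : ∀ (x : Subset (suc m)) → ∣ x ∣ ≡ k → InQ x
  qx x ∣x∣ = subst (λ c → suc m ≤ℕ 2 * c) (sym ∣x∣) n≤2k

proposition2p5 :
    -- (i)
    (∀ (n k : ℕ) (x : Subset n) → ∣ x ∣ ≡ k → n ≤ℕ 2 * k → k ≤ℕ n → 2 * k ≢ n + 1 →
      (is : Fin (2 * k ∸ n) → Fin n) → (∀ u v → u < v → is u < is v) →
      (∀ a → (csg x a ≡ s*) ⇔ (∃ λ u → is u ≡ a)) →
      (∀ (y : Subset n) → ∣ y ∣ ≡ k ∸ 1 → InQ y → (y ≺ x) ⇔ (∃ λ u → y ≡ x - is u))
      × (∀ u → MaxI′ (x - is u) (cinterval (is (predMod u)) (is u))))
    ×
    -- (ii)
    (∀ (n k : ℕ) (y : Subset n) → n + 2 ≤ℕ 2 * k → k ≤ℕ n → ∣ y ∣ ≡ k ∸ 1 →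
      (s : ℕ) (js prs : Fin s → Fin n) →
      (∀ r → csg y (js r) ≡ s1 × IsPr′ y (js r) (prs r) × MaxI′ y (cinterval (js r) (prs r))) →
      (∀ J → MaxI′ y J → ∃ λ r → J ≡ cinterval (js r) (prs r)) →
      (∀ r r′ → cinterval (js r) (prs r) ≡ cinterval (js r′) (prs r′) → r ≡ r′) →
      (∀ r r′ → y ∪ ⁅ prs r ⁆ ≡ y ∪ ⁅ prs r′ ⁆ → r ≡ r′)
      × (∀ (x : Subset n) → ∣ x ∣ ≡ k → (y ≺ x) ⇔ (∃ λ r → x ≡ y ∪ ⁅ prs r ⁆)))
proposition2p5 = proposition2p5-i , proposition2p5-ii
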